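{- Let $d\ge 2$ be an integer and let $G=(V,E)$ be a finite connected graph with vertices $v_1,\dots,v_n$ and edges $e_1,\dots,e_m$, where $e_i=(u_i,w_i)$. Given $\mathbf{y}=(y_{e_1},\dots,y_{e_m})\in\mathbb{G}_d^m$, there exists $\mathbf{x}=(x_{v_1},\dots,x_{v_n})\in\mathbb{G}_d^n$ with $y_{e_i}=x_{u_i}x_{w_i}$ for every $i=1,\dots,m$ if and only if $\mathbf{y}^{\mathbf{u}}=1$ for every $\mathbf{u}\in\ker_{\mathbb{Z}_d}(A_G)$. Moreover, when such $\mathbf{x}$ exists: if $g=0$ there are exactly $d$ such $\mathbf{x}\in\mathbb{G}_d^n$; if $g=2$ and $d$ is even there are exactly two; otherwise there is exactly one.
   Context: $\mathbb{G}_d\subset\mathbb{C}$ is the group of $d$-th roots of unity. $A_G\in\mathbb{Z}^{n\times m}$ is the incidence matrix of $G$: entry $(i,j)$ is $1$ if $v_i$ is incident with $e_j$, $0$ otherwise. $\ker_{\mathbb{Z}_d}(A_G)=\{\mathbf{u}\in\mathbb{Z}_d^m : A_G\mathbf{u}\equiv0\pmod d\}$, and for $\mathbf{u}=(u_1,\dots,u_m)$ we write $\mathbf{y}^{\mathbf{u}}=y_{e_1}^{u_1}\cdots y_{e_m}^{u_m}$ (well defined since $y_{e_i}^d=1$). $g$ denotes the gcd of all maximal ($n\times n$) minors of $A_G$ (with $g=0$ if all of them vanish or there are none). -}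

module Defs where

open import Data.Nat as ℕ using (ℕ; zero; suc; _%_; NonZero)
open import Data.Nat.GCD using (gcd)
open import Data.Integer as ℤ using (ℤ; ∣_∣)
open import Data.Fin using (Fin; zero; suc; toℕ; punchIn; _≟_)
open import Data.Vec using (Vec; lookup)
open import Data.List using (List; []; _∷_; _++_; map; foldr; length)
open import Data.List.Membership.Propositional using (_∈_)
open import Data.List.Relation.Unary.Unique.Propositional using (Unique)
open import Data.Product using (Σ; ∃; _×_; _,_)
open import Data.Sum using (_⊎_)
open import Relation.Nullary using (¬_; does)
open import Relation.Binary.PropositionalEquality using (_≡_)
open import Function.Bundles using (_⇔_)
open import Data.Bool using (if_then_else_; _∨_)

sumℕ : ∀ {k} → (Fin k → ℕ) → ℕ
sumℕ {zero}  f = 0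
sumℕ {suc k} f = f zero ℕ.+ sumℕ (λ i → f (suc i))

sumℤ : ∀ {k} → (Fin k → ℤ) → ℤ
sumℤ {zero}  f = ℤ.0ℤ
sumℤ {suc k} f = f zero ℤ.+ sumℤ (λ i → f (suc i))

Loopless : ∀ {n m} → (Fin m → Fin n) → (Fin m → Fin n) → Set
Loopless src tgt = ∀ j → ¬ (src j ≡ tgt j)

NoMultiEdges : ∀ {n m} → (Fin m → Fin n) → (Fin m → Fin n) → Set
NoMultiEdges src tgt =
  ∀ i j → ((src i ≡ src j × tgt i ≡ tgt j) ⊎ (src i ≡ tgt j × tgt i ≡ src j)) → i ≡ j

Adj : ∀ {n m} → (Fin m → Fin n) → (Fin m → Fin n) → Fin n → Fin n → Set
Adj src tgt a b = ∃ λ j → (src j ≡ a × tgt j ≡ b) ⊎ (src j ≡ b × tgt j ≡ a)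

data Reach {n m} (src tgt : Fin m → Fin n) : Fin n → Fin n → Set where
  here : ∀ {a} → Reach src tgt a a
  step : ∀ {a b c} → Adj src tgt a b → Reach src tgt b c → Reach src tgt a c

Connected : ∀ {n m} → (Fin m → Fin n) → (Fin m → Fin n) → Set
Connected src tgt = ∀ a b → Reach src tgt a b

incℕ : ∀ {n m} → (Fin m → Fin n) → (Fin m → Fin n) → Fin n → Fin m → ℕ
incℕ src tgt v j = if does (v ≟ src j) ∨ does (v ≟ tgt j) then 1 else 0

incℤ : ∀ {n m} → (Fin m → Fin n) → (Fin m → Fin n) → Fin n → Fin m → ℤ
incℤ src tgt v j = ℤ.+ incℕ src tgt v j

signℤ : ℕ → ℤ
signℤ zero          = ℤ.1ℤ
signℤ (suc zero)    = ℤ.-1ℤ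
signℤ (suc (suc k)) = signℤ k

det : ∀ k → (Fin k → Fin k → ℤ) → ℤ
det zero    M = ℤ.1ℤ
det (suc k) M =
  sumℤ (λ j → signℤ (toℕ j) ℤ.* (M zero j ℤ.* det k (λ r c → M (suc r) (punchIn j c))))

-- all strictly increasing maps Fin k → Fin m (i.e. all k-element column sets)
choose : ∀ k m → List (Fin k → Fin m)
choose zero    m       = (λ ()) ∷ []
choose (suc k) zero    = []
choose (suc k) (suc m) =
  map (λ f i → suc (f i)) (choose (suc k) m) ++
  map (λ f → λ { zero → zero ; (suc i) → suc (f i) }) (choose k m)

-- g = gcd of all maximal (n × n) minors of A_G  (0 if there are none / all vanish)
gMinors : ∀ {n m} → (Fin m → Fin n) → (Fin m → Fin n) → ℕ
gMinors {n} {m} src tgt =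
  foldr gcd 0 (map (λ c → ∣ det n (λ r k → incℤ src tgt r (c k)) ∣) (choose n m))

-- 𝔾_d is identified with ℤ_d = Fin d via ζ^a ↦ a (ζ = e^{2πi/d}).
-- Multiplication becomes addition mod d, and 1 becomes 0.

IsSol : ∀ {n m d} .{{_ : NonZero d}} → (Fin m → Fin n) → (Fin m → Fin n) →
        (Fin m → Fin d) → Vec (Fin d) n → Set
IsSol {d = d} src tgt y x =
  ∀ j → toℕ (y j) ≡ (toℕ (lookup x (src j)) ℕ.+ toℕ (lookup x (tgt j))) % d

InKer : ∀ {n m d} .{{_ : NonZero d}} → (Fin m → Fin n) → (Fin m → Fin n) →
        (Fin m → Fin d) → Set
InKer {d = d} src tgt u = ∀ v → sumℕ (λ j → incℕ src tgt v j ℕ.* toℕ (u j)) % d ≡ 0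

-- y^u = 1   (exponent of y^u is Σ u_j·y_j mod d)
PowIsOne : ∀ {m d} .{{_ : NonZero d}} → (Fin m → Fin d) → (Fin m → Fin d) → Set
PowIsOne {d = d} y u = sumℕ (λ j → toℕ (u j) ℕ.* toℕ (y j)) % d ≡ 0

ExactlyN : ∀ {n d} → ℕ → (Vec (Fin d) n → Set) → Set
ExactlyN {n} {d} k P =
  Σ (List (Vec (Fin d) n)) λ xs → length xs ≡ k × Unique xs × (∀ x → (x ∈ xs) ⇔ P x)

-- Fix for every vertex v a walk from vertex 0 and let σ v = ±1 be its parity. A solution x is
-- determined by x₀ (x_v = σ_v (x₀ − Φ_v), with Φ_v read off y along the walk), and x₀ = t gives a
-- solution iff (σ_s + σ_t)·t ≡ ⟨c_e, y⟩ for every edge e = (s, t), where c_e is the closed walk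
-- through e. If G is bipartite all coefficients σ_s + σ_t vanish, c_e lies in the kernel, and
-- every t works: d solutions; every maximal minor vanishes since the rows, weighted by σ, sum to
-- zero. Otherwise some edge is odd and the conditions collapse to 2t ≡ K, with one solution for
-- odd d and two for even d (K is even by the kernel condition). Then g = 2: the rows of a minor
-- sum to twice the all-ones row, and contracting edges of G, seen as a signed graph, down to a
-- single vertex with an unbalanced loop produces a maximal minor ±2.

module Submission where

open import Defs
open import Level using (0ℓ)
open import Data.Nat as ℕ using (ℕ; zero; suc; _≤_; NonZero)
import Data.Nat.Properties as ℕP
import Data.Nat.DivMod as ℕD
open import Data.Nat.Divisibility using (_∣_; divides; ∣-trans; ∣-antisym; _∣0)
open import Data.Nat.GCD using (gcd; gcd[m,n]∣m; gcd[m,n]∣n; gcd-greatest; gcd[0,0]≡0)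
open import Data.Integer as ℤ using (ℤ; +_; -[1+_]; ∣_∣; _+_; _*_; -_; _-_; 0ℤ; 1ℤ; -1ℤ)
import Data.Integer.Properties as ℤP
open import Data.Integer.DivMod using (_%ℕ_; _/ℕ_; n%ℕd<d; a≡a%ℕn+[a/ℕn]*n)
open import Data.Integer.Tactic.RingSolver using (solve-∀)
open import Data.Fin as Fin using (Fin; zero; suc; toℕ; punchIn; punchOut; _≟_)
import Data.Fin.Properties as FinP
open import Data.Fin.Permutation.Components using (transpose; transpose-inverse)
open import Data.Vec using (Vec; []; lookup; tabulate)
import Data.Vec.Properties as VecP
open import Data.List using (List; []; _∷_; map; foldr; length; allFin)
import Data.List.Properties as ListP
open import Data.List.Membership.Propositional using (_∈_)
open import Data.List.Membership.Propositional.Properties using (∈-map⁺; ∈-map⁻; ∈-++⁺ˡ; ∈-++⁺ʳ; ∈-++⁻; ∈-allFin)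
open import Data.List.Relation.Unary.Any using (here; there)
open import Data.List.Relation.Unary.All using ([]; _∷_)
open import Data.List.Relation.Unary.AllPairs using ([]; _∷_)
open import Data.List.Relation.Unary.Unique.Propositional using (Unique)
import Data.List.Relation.Unary.Unique.Propositional.Properties as UniqueP
open import Data.Product using (Σ; ∃; _×_; _,_)
import Data.Product as Σ
open import Data.Sum using (_⊎_; inj₁; inj₂)
open import Data.Empty using (⊥-elim)
open import Data.Bool using (if_then_else_)
open import Relation.Nullary using (¬_; does; yes; no; Dec)
open import Relation.Binary.Bundles using (Setoid)
import Relation.Binary.Reasoning.Setoid as SetoidReasoning
open import Relation.Binary.PropositionalEquality
  using (_≡_; _≢_; refl; sym; trans; cong; cong₂; subst; subst₂; module ≡-Reasoning)
open import Function using (_∘_; case_of_)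
open import Function.Bundles using (_⇔_; mk⇔)
open ≡-Reasoning

sumℤ-cong : ∀ {k} {f g : Fin k → ℤ} → (∀ i → f i ≡ g i) → sumℤ f ≡ sumℤ g
sumℤ-cong {zero}  f≡g = refl
sumℤ-cong {suc k} f≡g = cong₂ _+_ (f≡g zero) (sumℤ-cong (f≡g ∘ suc))

sumℤ-zero : ∀ {k} (f : Fin k → ℤ) → (∀ i → f i ≡ 0ℤ) → sumℤ f ≡ 0ℤ
sumℤ-zero {zero}  f f≡0 = refl
sumℤ-zero {suc k} f f≡0 = cong₂ _+_ (f≡0 zero) (sumℤ-zero (f ∘ suc) (f≡0 ∘ suc))

sumℤ-+ : ∀ {k} (f g : Fin k → ℤ) → sumℤ (λ i → f i + g i) ≡ sumℤ f + sumℤ g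
sumℤ-+ {zero}  f g = refl
sumℤ-+ {suc k} f g = begin
  (f zero + g zero) + sumℤ (λ i → f (suc i) + g (suc i))
    ≡⟨ cong (_+_ (f zero + g zero)) (sumℤ-+ (f ∘ suc) (g ∘ suc)) ⟩
  (f zero + g zero) + (sumℤ (f ∘ suc) + sumℤ (g ∘ suc))
    ≡⟨ interchange (f zero) (g zero) (sumℤ (f ∘ suc)) (sumℤ (g ∘ suc)) ⟩
  (f zero + sumℤ (f ∘ suc)) + (g zero + sumℤ (g ∘ suc)) ∎
  where
  interchange : ∀ a b c e → (a + b) + (c + e) ≡ (a + c) + (b + e)
  interchange = solve-∀

sumℤ-* : ∀ {k} (a : ℤ) (f : Fin k → ℤ) → sumℤ (λ i → a * f i) ≡ a * sumℤ f
sumℤ-* {zero}  a f = sym (ℤP.*-zeroʳ a)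
sumℤ-* {suc k} a f =
  trans (cong (_+_ (a * f zero)) (sumℤ-* a (f ∘ suc))) (sym (ℤP.*-distribˡ-+ a (f zero) _))

sumℤ-swap : ∀ {k l} (F : Fin k → Fin l → ℤ) →
  sumℤ (λ i → sumℤ (F i)) ≡ sumℤ (λ j → sumℤ (λ i → F i j))
sumℤ-swap {zero}  {l} F = sym (sumℤ-zero {l} (λ _ → 0ℤ) (λ _ → refl))
sumℤ-swap {suc k} {l} F = begin
  sumℤ (F zero) + sumℤ (λ i → sumℤ (F (suc i)))
    ≡⟨ cong (_+_ (sumℤ (F zero))) (sumℤ-swap (F ∘ suc)) ⟩
  sumℤ (F zero) + sumℤ (λ j → sumℤ (λ i → F (suc i) j))
    ≡⟨ sym (sumℤ-+ (F zero) _) ⟩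
  sumℤ (λ j → F zero j + sumℤ (λ i → F (suc i) j)) ∎

sumℤ-single : ∀ {k} (f : Fin k → ℤ) (p : Fin k) → (∀ i → i ≢ p → f i ≡ 0ℤ) → sumℤ f ≡ f p
sumℤ-single {suc k} f zero    f≡0 =
  trans (cong (_+_ (f zero)) (sumℤ-zero (f ∘ suc) (λ i → f≡0 (suc i) λ ())))
        (ℤP.+-identityʳ (f zero))
sumℤ-single {suc k} f (suc p) f≡0 =
  trans (cong₂ _+_ (f≡0 zero λ ()) (sumℤ-single (f ∘ suc) p (λ i i≢p → f≡0 (suc i) (i≢p ∘ FinP.suc-injective))))
        (ℤP.+-identityˡ (f (suc p)))

sumℕ-toℤ : ∀ {k} (f : Fin k → ℕ) → + sumℕ f ≡ sumℤ (λ i → + f i)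
sumℕ-toℤ {zero}  f = refl
sumℕ-toℤ {suc k} f = trans (ℤP.pos-+ (f zero) _) (cong (_+_ (+ f zero)) (sumℕ-toℤ (f ∘ suc)))

δ : ∀ {k} → Fin k → Fin k → ℤ
δ a b = if does (a ≟ b) then 1ℤ else 0ℤ

δ-refl : ∀ {k} (a : Fin k) → δ a a ≡ 1ℤ
δ-refl a with a ≟ a
... | yes _  = refl
... | no a≢a = ⊥-elim (a≢a refl)

δ-≢ : ∀ {k} {a b : Fin k} → a ≢ b → δ a b ≡ 0ℤ
δ-≢ {a = a} {b} a≢b with a ≟ b
... | yes a≡b = ⊥-elim (a≢b a≡b)
... | no _    = refl

δ-sym : ∀ {k} (a b : Fin k) → δ a b ≡ δ b a
δ-sym a b with a ≟ b | b ≟ a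
... | yes _   | yes _   = refl
... | no _    | no _    = refl
... | yes a≡b | no b≢a = ⊥-elim (b≢a (sym a≡b))
... | no a≢b  | yes b≡a = ⊥-elim (a≢b (sym b≡a))

sumℤ-δ : ∀ {k} (a : Fin k) (f : Fin k → ℤ) → sumℤ (λ i → δ a i * f i) ≡ f a
sumℤ-δ a f = begin
  sumℤ (λ i → δ a i * f i) ≡⟨ sumℤ-single _ a (λ i i≢a → cong (_* f i) (δ-≢ (i≢a ∘ sym))) ⟩
  δ a a * f a              ≡⟨ cong (_* f a) (δ-refl a) ⟩
  1ℤ * f a                 ≡⟨ ℤP.*-identityˡ (f a) ⟩
  f a                      ∎

sumℤ-δʳ : ∀ {k} (a : Fin k) (f : Fin k → ℤ) → sumℤ (λ i → f i * δ i a) ≡ f a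
sumℤ-δʳ a f = trans (sumℤ-cong (λ i → trans (ℤP.*-comm (f i) _) (cong (_* f i) (δ-sym i a)))) (sumℤ-δ a f)

Unit : ℤ → Set
Unit x = x ≡ 1ℤ ⊎ x ≡ -1ℤ

unit*self≡1 : ∀ {x} → Unit x → x * x ≡ 1ℤ
unit*self≡1 (inj₁ refl) = refl
unit*self≡1 (inj₂ refl) = refl

unit-* : ∀ {x y} → Unit x → Unit y → Unit (x * y)
unit-* (inj₁ refl) (inj₁ refl) = inj₁ refl
unit-* (inj₁ refl) (inj₂ refl) = inj₂ refl
unit-* (inj₂ refl) (inj₁ refl) = inj₂ refl
unit-* (inj₂ refl) (inj₂ refl) = inj₁ refl

unit-neg : ∀ {x} → Unit x → Unit (- x)
unit-neg (inj₁ refl) = inj₂ refl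
unit-neg (inj₂ refl) = inj₁ refl

∣unit∣≡1 : ∀ {x} → Unit x → ∣ x ∣ ≡ 1
∣unit∣≡1 (inj₁ refl) = refl
∣unit∣≡1 (inj₂ refl) = refl

unit-signℤ : ∀ n → Unit (signℤ n)
unit-signℤ zero          = inj₁ refl
unit-signℤ (suc zero)    = inj₂ refl
unit-signℤ (suc (suc n)) = unit-signℤ n

units-sum≢0⇒∣sum∣≡2 : ∀ {x y} → Unit x → Unit y → x + y ≢ 0ℤ → ∣ x + y ∣ ≡ 2
units-sum≢0⇒∣sum∣≡2 (inj₁ refl) (inj₁ refl) _   = refl
units-sum≢0⇒∣sum∣≡2 (inj₁ refl) (inj₂ refl) x+y≢0 = ⊥-elim (x+y≢0 refl)
units-sum≢0⇒∣sum∣≡2 (inj₂ refl) (inj₁ refl) x+y≢0 = ⊥-elim (x+y≢0 refl)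
units-sum≢0⇒∣sum∣≡2 (inj₂ refl) (inj₂ refl) _   = refl

units-sum≢0⇒≡ : ∀ {x y} → Unit x → Unit y → x + y ≢ 0ℤ → y ≡ x
units-sum≢0⇒≡ (inj₁ refl) (inj₁ refl) _   = refl
units-sum≢0⇒≡ (inj₁ refl) (inj₂ refl) x+y≢0 = ⊥-elim (x+y≢0 refl)
units-sum≢0⇒≡ (inj₂ refl) (inj₁ refl) x+y≢0 = ⊥-elim (x+y≢0 refl)
units-sum≢0⇒≡ (inj₂ refl) (inj₂ refl) _   = refl

x+y≡0⇒y≡-x : ∀ x y → x + y ≡ 0ℤ → y ≡ - x
x+y≡0⇒y≡-x x y x+y≡0 = begin
  y           ≡⟨ shuffle x y ⟩
  (x + y) - x ≡⟨ cong (_- x) x+y≡0 ⟩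
  0ℤ - x      ≡⟨ ℤP.+-identityˡ (- x) ⟩
  - x         ∎
  where
  shuffle : ∀ x y → y ≡ (x + y) - x
  shuffle = solve-∀

if-yes : ∀ {p} {P : Set p} {A : Set} (d : Dec P) {x y : A} → P → (if does d then x else y) ≡ x
if-yes (yes _) _  = refl
if-yes (no ¬p) p = ⊥-elim (¬p p)

if-no : ∀ {p} {P : Set p} {A : Set} (d : Dec P) {x y : A} → ¬ P → (if does d then x else y) ≡ y
if-no (yes p) ¬p = ⊥-elim (¬p p)
if-no (no _) _   = refl

-- Determinants

Mat : ℕ → Set
Mat k = Fin k → Fin k → ℤ

sign : ∀ {k} → Fin k → ℤ
sign j = signℤ (toℕ j)

minor : ∀ {k} → Mat (suc k) → Fin (suc k) → Mat k
minor M j r c = M (suc r) (punchIn j c)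

signℤ-suc : ∀ n → signℤ (suc n) ≡ - signℤ n
signℤ-suc zero          = refl
signℤ-suc (suc zero)    = refl
signℤ-suc (suc (suc n)) = signℤ-suc n

det-cong : ∀ k {M N : Mat k} → (∀ r c → M r c ≡ N r c) → det k M ≡ det k N
det-cong zero    M≡N = refl
det-cong (suc k) M≡N = sumℤ-cong λ j →
  cong₂ (λ a b → sign j * (a * b)) (M≡N zero j) (det-cong k (λ r c → M≡N (suc r) (punchIn j c)))

AgreeOff : ∀ {k} → Fin k → Mat k → Mat k → Set
AgreeOff i M N = ∀ r → r ≢ i → ∀ c → M r c ≡ N r c

agreeOff-minor : ∀ {k} {i : Fin k} {M N : Mat (suc k)} → AgreeOff (suc i) M N →
                 ∀ j → AgreeOff i (minor M j) (minor N j)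
agreeOff-minor M≈N j r r≢i c = M≈N (suc r) (r≢i ∘ FinP.suc-injective) (punchIn j c)

agreeOff-minor₀ : ∀ {k} {M N : Mat (suc k)} → AgreeOff zero M N → ∀ j r c → minor M j r c ≡ minor N j r c
agreeOff-minor₀ M≈N j r c = M≈N (suc r) (λ ()) (punchIn j c)

laplaceTerm : ∀ {k} → Mat (suc k) → Fin (suc k) → ℤ
laplaceTerm {k} M j = sign j * (M zero j * det k (minor M j))

det-additive : ∀ k (M N P : Mat k) (i : Fin k) → AgreeOff i M P → AgreeOff i N P →
  (∀ c → P i c ≡ M i c + N i c) → det k P ≡ det k M + det k N
det-additive (suc k) M N P zero M≈P N≈P Pᵢ =
  trans (sumℤ-cong term) (sumℤ-+ (laplaceTerm M) (laplaceTerm N))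
  where
  distrib : ∀ s x y d → s * ((x + y) * d) ≡ s * (x * d) + s * (y * d)
  distrib = solve-∀
  minorᴹ : ∀ Q → AgreeOff zero Q P → ∀ j → det k (minor P j) ≡ det k (minor Q j)
  minorᴹ Q Q≈P j = det-cong k (λ r c → sym (agreeOff-minor₀ Q≈P j r c))
  term : ∀ j → laplaceTerm P j ≡ laplaceTerm M j + laplaceTerm N j
  term j = begin
    sign j * (P zero j * det k (minor P j))
      ≡⟨ cong (λ x → sign j * (x * det k (minor P j))) (Pᵢ j) ⟩
    sign j * ((M zero j + N zero j) * det k (minor P j))
      ≡⟨ distrib (sign j) (M zero j) (N zero j) _ ⟩
    sign j * (M zero j * det k (minor P j)) + sign j * (N zero j * det k (minor P j))
      ≡⟨ cong₂ (λ d e → sign j * (M zero j * d) + sign j * (N zero j * e)) (minorᴹ M M≈P j) (minorᴹ N N≈P j) ⟩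
    laplaceTerm M j + laplaceTerm N j ∎
det-additive (suc k) M N P (suc i) M≈P N≈P Pᵢ =
  trans (sumℤ-cong term) (sumℤ-+ (laplaceTerm M) (laplaceTerm N))
  where
  distrib : ∀ s x d e → s * (x * (d + e)) ≡ s * (x * d) + s * (x * e)
  distrib = solve-∀
  term : ∀ j → laplaceTerm P j ≡ laplaceTerm M j + laplaceTerm N j
  term j = begin
    sign j * (P zero j * det k (minor P j))
      ≡⟨ cong (λ d → sign j * (P zero j * d))
           (det-additive k (minor M j) (minor N j) (minor P j) i
             (agreeOff-minor M≈P j) (agreeOff-minor N≈P j) (Pᵢ ∘ punchIn j)) ⟩
    sign j * (P zero j * (det k (minor M j) + det k (minor N j)))
      ≡⟨ distrib (sign j) (P zero j) _ _ ⟩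
    sign j * (P zero j * det k (minor M j)) + sign j * (P zero j * det k (minor N j))
      ≡⟨ cong₂ (λ x y → sign j * (x * det k (minor M j)) + sign j * (y * det k (minor N j)))
           (sym (M≈P zero (λ ()) j)) (sym (N≈P zero (λ ()) j)) ⟩
    laplaceTerm M j + laplaceTerm N j ∎

det-homogeneous : ∀ k (M P : Mat k) (i : Fin k) (a : ℤ) → AgreeOff i M P →
  (∀ c → P i c ≡ a * M i c) → det k P ≡ a * det k M
det-homogeneous (suc k) M P zero a M≈P Pᵢ =
  trans (sumℤ-cong term) (sumℤ-* a (laplaceTerm M))
  where
  rearrange : ∀ a s x d → s * ((a * x) * d) ≡ a * (s * (x * d))
  rearrange = solve-∀
  term : ∀ j → laplaceTerm P j ≡ a * laplaceTerm M j
  term j = begin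
    sign j * (P zero j * det k (minor P j))
      ≡⟨ cong₂ (λ x d → sign j * (x * d)) (Pᵢ j) (det-cong k (λ r c → sym (agreeOff-minor₀ M≈P j r c))) ⟩
    sign j * ((a * M zero j) * det k (minor M j))
      ≡⟨ rearrange a (sign j) (M zero j) _ ⟩
    a * laplaceTerm M j ∎
det-homogeneous (suc k) M P (suc i) a M≈P Pᵢ =
  trans (sumℤ-cong term) (sumℤ-* a (laplaceTerm M))
  where
  rearrange : ∀ a s x d → s * (x * (a * d)) ≡ a * (s * (x * d))
  rearrange = solve-∀
  term : ∀ j → laplaceTerm P j ≡ a * laplaceTerm M j
  term j = begin
    sign j * (P zero j * det k (minor P j))
      ≡⟨ cong₂ (λ x d → sign j * (x * d)) (sym (M≈P zero (λ ()) j))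
           (det-homogeneous k (minor M j) (minor P j) i a (agreeOff-minor M≈P j) (Pᵢ ∘ punchIn j)) ⟩
    sign j * (M zero j * (a * det k (minor M j)))
      ≡⟨ rearrange a (sign j) (M zero j) _ ⟩
    a * laplaceTerm M j ∎

det-zero-row : ∀ k (M : Mat k) (i : Fin k) → (∀ c → M i c ≡ 0ℤ) → det k M ≡ 0ℤ
det-zero-row k M i Mᵢ≡0 = det-homogeneous k M M i 0ℤ (λ _ _ _ → refl) Mᵢ≡0

sumℤ-offDiagonal-antisym : ∀ N (H : Fin (suc N) → Fin (suc N) → ℤ) →
  (∀ a b → a ≢ b → H a b ≡ - H b a) → sumℤ (λ j → sumℤ (λ l → H j (punchIn j l))) ≡ 0ℤ
sumℤ-offDiagonal-antisym zero    H anti = refl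
sumℤ-offDiagonal-antisym (suc N) H anti = begin
  sumℤ row₀ + sumℤ (λ j → H (suc j) zero + sumℤ (λ l → H (suc j) (suc (punchIn j l))))
    ≡⟨ cong (_+_ (sumℤ row₀)) (sumℤ-+ col₀ (λ j → sumℤ (λ l → H (suc j) (suc (punchIn j l))))) ⟩
  sumℤ row₀ + (sumℤ col₀ + sumℤ (λ j → sumℤ (λ l → H (suc j) (suc (punchIn j l)))))
    ≡⟨ sym (ℤP.+-assoc (sumℤ row₀) (sumℤ col₀) _) ⟩
  (sumℤ row₀ + sumℤ col₀) + sumℤ (λ j → sumℤ (λ l → H (suc j) (suc (punchIn j l))))
    ≡⟨ cong₂ _+_ row₀+col₀≡0
         (sumℤ-offDiagonal-antisym N (λ a b → H (suc a) (suc b)) (λ a b a≢b → anti (suc a) (suc b) (a≢b ∘ FinP.suc-injective))) ⟩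
  0ℤ ∎
  where
  row₀ col₀ : Fin (suc N) → ℤ
  row₀ l = H zero (suc l)
  col₀ j = H (suc j) zero
  row₀+col₀≡0 : sumℤ row₀ + sumℤ col₀ ≡ 0ℤ
  row₀+col₀≡0 = trans (sym (sumℤ-+ row₀ col₀))
    (sumℤ-zero _ (λ l → trans (cong (_+_ (row₀ l)) (anti (suc l) zero (λ ()))) (ℤP.+-inverseʳ (row₀ l))))

punchIn-punchOut-comm : ∀ {N} (j j′ : Fin (suc (suc N))) (j≢j′ : j ≢ j′) (j′≢j : j′ ≢ j) (c : Fin N) →
  punchIn j (punchIn (punchOut j≢j′) c) ≡ punchIn j′ (punchIn (punchOut j′≢j) c)
punchIn-punchOut-comm zero zero j≢j′ _ c = ⊥-elim (j≢j′ refl)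
punchIn-punchOut-comm zero (suc j′) _ _ c = refl
punchIn-punchOut-comm (suc j) zero _ _ c = refl
punchIn-punchOut-comm {suc N} (suc j) (suc j′) _ _ zero = refl
punchIn-punchOut-comm {suc N} (suc j) (suc j′) j≢j′ j′≢j (suc c) =
  cong suc (punchIn-punchOut-comm j j′ (j≢j′ ∘ cong suc) (j′≢j ∘ cong suc) c)

sign-punchOut-antisym : ∀ {N} (j j′ : Fin (suc (suc N))) (j≢j′ : j ≢ j′) (j′≢j : j′ ≢ j) →
  sign j * sign (punchOut j≢j′) ≡ - (sign j′ * sign (punchOut j′≢j))
sign-punchOut-antisym zero zero j≢j′ _ = ⊥-elim (j≢j′ refl)
sign-punchOut-antisym zero (suc j′) _ _ =
  trans (negneg (sign j′)) (cong (λ s → - (s * 1ℤ)) (sym (signℤ-suc (toℕ j′))))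
  where
  negneg : ∀ x → 1ℤ * x ≡ - (- x * 1ℤ)
  negneg = solve-∀
sign-punchOut-antisym (suc j) zero _ _ =
  trans (cong (_* 1ℤ) (signℤ-suc (toℕ j))) (negswap (sign j))
  where
  negswap : ∀ x → - x * 1ℤ ≡ - (1ℤ * x)
  negswap = solve-∀
sign-punchOut-antisym {zero} (suc zero) (suc zero) j≢j′ _ = ⊥-elim (j≢j′ refl)
sign-punchOut-antisym {suc N} (suc j) (suc j′) j≢j′ j′≢j = begin
  sign (suc j) * sign (suc o)
    ≡⟨ cong₂ _*_ (signℤ-suc (toℕ j)) (signℤ-suc (toℕ o)) ⟩
  (- sign j) * (- sign o)
    ≡⟨ neg*neg (sign j) (sign o) ⟩
  sign j * sign o
    ≡⟨ sign-punchOut-antisym j j′ (j≢j′ ∘ cong suc) (j′≢j ∘ cong suc) ⟩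
  - (sign j′ * sign o′)
    ≡⟨ cong -_ (sym (neg*neg (sign j′) (sign o′))) ⟩
  - ((- sign j′) * (- sign o′))
    ≡⟨ cong -_ (sym (cong₂ _*_ (signℤ-suc (toℕ j′)) (signℤ-suc (toℕ o′)))) ⟩
  - (sign (suc j′) * sign (suc o′)) ∎
  where
  o o′ : Fin (suc N)
  o = punchOut (j≢j′ ∘ cong suc)
  o′ = punchOut (j′≢j ∘ cong suc)
  neg*neg : ∀ x y → (- x) * (- y) ≡ x * y
  neg*neg = solve-∀

module _ {k} (a : Fin (suc (suc k)) → ℤ) (R : Fin k → Fin (suc (suc k)) → ℤ) where

  -- the term of the Laplace expansion along two equal first rows a that picks columns j and j′
  pairTerm : Fin (suc (suc k)) → Fin (suc (suc k)) → ℤ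
  pairTerm j j′ with j ≟ j′
  ... | yes _    = 0ℤ
  ... | no j≢j′ = (sign j * sign (punchOut j≢j′)) *
                  ((a j * a j′) * det k (λ r c → R r (punchIn j (punchIn (punchOut j≢j′) c))))

  pairTerm-punchIn : ∀ j l → pairTerm j (punchIn j l) ≡
    (sign j * sign l) * ((a j * a (punchIn j l)) * det k (λ r c → R r (punchIn j (punchIn l c))))
  pairTerm-punchIn j l with j ≟ punchIn j l
  ... | yes j≡ = ⊥-elim (FinP.punchInᵢ≢i j l (sym j≡))
  ... | no j≢  = cong (λ o → (sign j * sign o) * ((a j * a (punchIn j l)) * det k (λ r c → R r (punchIn j (punchIn o c)))))
                      (trans (FinP.punchOut-cong j refl) (FinP.punchOut-punchIn j))

  pairTerm-antisym : ∀ j j′ → j ≢ j′ → pairTerm j j′ ≡ - pairTerm j′ j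
  pairTerm-antisym j j′ j≢j′ with j ≟ j′ | j′ ≟ j
  ... | yes j≡j′ | _        = ⊥-elim (j≢j′ j≡j′)
  ... | no _     | yes j′≡j = ⊥-elim (j≢j′ (sym j′≡j))
  ... | no ne    | no ne′   = begin
    (sign j * sign (punchOut ne)) * ((a j * a j′) * det k (λ r c → R r (punchIn j (punchIn (punchOut ne) c))))
      ≡⟨ cong₂ (λ s d → s * ((a j * a j′) * d)) (sign-punchOut-antisym j j′ ne ne′)
               (det-cong k (λ r c → cong (R r) (punchIn-punchOut-comm j j′ ne ne′ c))) ⟩
    (- s′) * ((a j * a j′) * D′)
      ≡⟨ reorder s′ (a j) (a j′) D′ ⟩
    - (s′ * ((a j′ * a j) * D′)) ∎
    where
    s′ D′ : ℤ
    s′ = sign j′ * sign (punchOut ne′)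
    D′ = det k (λ r c → R r (punchIn j′ (punchIn (punchOut ne′) c)))
    reorder : ∀ s x y d → (- s) * ((x * y) * d) ≡ - (s * ((y * x) * d))
    reorder = solve-∀

det-equal-rows₀₁ : ∀ k (M : Mat (suc (suc k))) → (∀ c → M zero c ≡ M (suc zero) c) → det (suc (suc k)) M ≡ 0ℤ
det-equal-rows₀₁ k M M₀≡M₁ = begin
  sumℤ (λ j → sign j * (M zero j * sumℤ (λ l → sign l * (M (suc zero) (punchIn j l) * D j l))))
    ≡⟨ sumℤ-cong (λ j → trans (pull j) (sumℤ-cong (asPair j))) ⟩
  sumℤ (λ j → sumℤ (λ l → pairTerm (M zero) R j (punchIn j l)))
    ≡⟨ sumℤ-offDiagonal-antisym (suc k) (pairTerm (M zero) R) (pairTerm-antisym (M zero) R) ⟩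
  0ℤ ∎
  where
  R : Fin k → Fin (suc (suc k)) → ℤ
  R r = M (suc (suc r))
  D : Fin (suc (suc k)) → Fin (suc k) → ℤ
  D j l = det k (λ r c → R r (punchIn j (punchIn l c)))
  pull : ∀ j → sign j * (M zero j * sumℤ (λ l → sign l * (M (suc zero) (punchIn j l) * D j l)))
             ≡ sumℤ (λ l → sign j * (M zero j * (sign l * (M (suc zero) (punchIn j l) * D j l))))
  pull j = sym (trans (sumℤ-* (sign j) (λ l → M zero j * (sign l * (M (suc zero) (punchIn j l) * D j l))))
                      (cong (sign j *_) (sumℤ-* (M zero j) (λ l → sign l * (M (suc zero) (punchIn j l) * D j l)))))
  reorder : ∀ s x t y d → s * (x * (t * (y * d))) ≡ (s * t) * ((x * y) * d)
  reorder = solve-∀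
  asPair : ∀ j l → sign j * (M zero j * (sign l * (M (suc zero) (punchIn j l) * D j l)))
                 ≡ pairTerm (M zero) R j (punchIn j l)
  asPair j l = begin
    sign j * (M zero j * (sign l * (M (suc zero) (punchIn j l) * D j l)))
      ≡⟨ cong (λ x → sign j * (M zero j * (sign l * (x * D j l)))) (sym (M₀≡M₁ (punchIn j l))) ⟩
    sign j * (M zero j * (sign l * (M zero (punchIn j l) * D j l)))
      ≡⟨ reorder (sign j) (M zero j) (sign l) _ _ ⟩
    (sign j * sign l) * ((M zero j * M zero (punchIn j l)) * D j l)
      ≡⟨ sym (pairTerm-punchIn (M zero) R j l) ⟩
    pairTerm (M zero) R j (punchIn j l) ∎

setRow : ∀ {k} → Fin k → (Fin k → ℤ) → Mat k → Mat k
setRow i x M r c = if does (r ≟ i) then x c else M r c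

setRow-≡ : ∀ {k} (i : Fin k) x M c → setRow i x M i c ≡ x c
setRow-≡ i x M c with i ≟ i
... | yes _  = refl
... | no i≢i = ⊥-elim (i≢i refl)

setRow-≢ : ∀ {k} {i r : Fin k} x M c → r ≢ i → setRow i x M r c ≡ M r c
setRow-≢ {i = i} {r} x M c r≢i with r ≟ i
... | yes r≡i = ⊥-elim (r≢i r≡i)
... | no _    = refl

setRow-agreeOff : ∀ {k} (i : Fin k) x y M → AgreeOff i (setRow i x M) (setRow i y M)
setRow-agreeOff i x y M r r≢i c = trans (setRow-≢ x M c r≢i) (sym (setRow-≢ y M c r≢i))

setRow-self : ∀ {k} (i : Fin k) M r c → setRow i (M i) M r c ≡ M r c
setRow-self i M r c with r ≟ i
... | yes refl = refl
... | no _     = refl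

det-setRow-* : ∀ k (M : Mat k) (i : Fin k) (a : ℤ) (x : Fin k → ℤ) →
  det k (setRow i (λ c → a * x c) M) ≡ a * det k (setRow i x M)
det-setRow-* k M i a x = det-homogeneous k (setRow i x M) (setRow i (λ c → a * x c) M) i a
  (setRow-agreeOff i x (λ c → a * x c) M)
  (λ c → trans (setRow-≡ i (λ c → a * x c) M c) (cong (a *_) (sym (setRow-≡ i x M c))))

det-setRow-+ : ∀ k (M : Mat k) (i : Fin k) (x y : Fin k → ℤ) →
  det k (setRow i (λ c → x c + y c) M) ≡ det k (setRow i x M) + det k (setRow i y M)
det-setRow-+ k M i x y = det-additive k (setRow i x M) (setRow i y M) (setRow i (λ c → x c + y c) M) i
  (setRow-agreeOff i x (λ c → x c + y c) M) (setRow-agreeOff i y (λ c → x c + y c) M)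
  (λ c → trans (setRow-≡ i (λ c → x c + y c) M c) (sym (cong₂ _+_ (setRow-≡ i x M c) (setRow-≡ i y M c))))

swapRows : ∀ {k} → Fin k → Fin k → Mat k → Mat k
swapRows i j M r = M (transpose i j r)

transpose-self : ∀ {n} (i j : Fin n) → transpose i j i ≡ j
transpose-self i j with i ≟ i
... | yes _  = refl
... | no i≢i = ⊥-elim (i≢i refl)

transpose-same : ∀ {n} (i k : Fin n) → transpose i i k ≡ k
transpose-same i k with k ≟ i
... | yes refl = refl
... | no k≢i with k ≟ i
...   | yes k≡i = ⊥-elim (k≢i k≡i)
...   | no _    = refl

AlternatingAt : ∀ k → Fin k → Fin k → Set
AlternatingAt k i j = ∀ N → (∀ c → N i c ≡ N j c) → det k N ≡ 0ℤ

setRows : ∀ {k} → Fin k → Fin k → (Fin k → ℤ) → (Fin k → ℤ) → Mat k → Mat k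
setRows i j x y M = setRow i x (setRow j y M)

module _ {k} {i j : Fin k} (i≢j : i ≢ j) (M : Mat k) where

  setRows-≡ʳ : ∀ x y c → setRows i j x y M j c ≡ y c
  setRows-≡ʳ x y c = trans (setRow-≢ x (setRow j y M) c (i≢j ∘ sym)) (setRow-≡ j y M c)

  setRows-agreeOffʳ : ∀ x y y′ → AgreeOff j (setRows i j x y M) (setRows i j x y′ M)
  setRows-agreeOffʳ x y y′ r r≢j c with r ≟ i
  ... | yes _ = refl
  ... | no _  = setRow-agreeOff j y y′ M r r≢j c

  det-setRows-+ʳ : ∀ x y y′ →
    det k (setRows i j x (λ c → y c + y′ c) M) ≡ det k (setRows i j x y M) + det k (setRows i j x y′ M)
  det-setRows-+ʳ x y y′ = det-additive k (setRows i j x y M) (setRows i j x y′ M) (setRows i j x y+y′ M) j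
    (setRows-agreeOffʳ x y y+y′) (setRows-agreeOffʳ x y′ y+y′)
    (λ c → trans (setRows-≡ʳ x y+y′ c) (sym (cong₂ _+_ (setRows-≡ʳ x y c) (setRows-≡ʳ x y′ c))))
    where
    y+y′ : Fin k → ℤ
    y+y′ c = y c + y′ c

  setRows-own : ∀ r c → setRows i j (M i) (M j) M r c ≡ M r c
  setRows-own r c with r ≟ i
  ... | yes refl = refl
  ... | no _ with r ≟ j
  ... | yes refl = refl
  ... | no _     = refl

  setRows-swapped : ∀ r c → setRows i j (M j) (M i) M r c ≡ swapRows i j M r c
  setRows-swapped r c with r ≟ i
  ... | yes refl = refl
  ... | no _ with r ≟ j
  ... | yes refl = refl
  ... | no _     = refl

-- D(x, y) = det with rows i, j set to x, y is bilinear and vanishes on the diagonal,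
-- so D(Mᵢ, Mⱼ) + D(Mⱼ, Mᵢ) = D(Mᵢ + Mⱼ, Mᵢ + Mⱼ) − D(Mᵢ, Mᵢ) − D(Mⱼ, Mⱼ) = 0
det-swapRows-of-alternating : ∀ k (M : Mat k) {i j} → i ≢ j → AlternatingAt k i j →
  det k M + det k (swapRows i j M) ≡ 0ℤ
det-swapRows-of-alternating k M {i} {j} i≢j alt = begin
  det k M + det k (swapRows i j M)
    ≡⟨ cong₂ _+_ (sym (det-cong k (setRows-own i≢j M))) (sym (det-cong k (setRows-swapped i≢j M))) ⟩
  D (M i) (M j) + D (M j) (M i)
    ≡⟨ cong₂ _+_ (sym (trans (cong (λ z → z + D (M i) (M j)) (diag (M i))) (ℤP.+-identityˡ (D (M i) (M j)))))
                 (sym (trans (cong (_+_ (D (M j) (M i))) (diag (M j))) (ℤP.+-identityʳ (D (M j) (M i))))) ⟩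
  (D (M i) (M i) + D (M i) (M j)) + (D (M j) (M i) + D (M j) (M j))
    ≡⟨ sym (cong₂ _+_ (det-setRows-+ʳ i≢j M (M i) (M i) (M j)) (det-setRows-+ʳ i≢j M (M j) (M i) (M j))) ⟩
  D (M i) S + D (M j) S
    ≡⟨ sym (det-setRow-+ k (setRow j S M) i (M i) (M j)) ⟩
  D S S
    ≡⟨ diag S ⟩
  0ℤ ∎
  where
  S : Fin k → ℤ
  S c = M i c + M j c
  D : (Fin k → ℤ) → (Fin k → ℤ) → ℤ
  D x y = det k (setRows i j x y M)
  diag : ∀ x → D x x ≡ 0ℤ
  diag x = alt (setRows i j x x M) (λ c → trans (setRow-≡ i x (setRow j x M) c) (sym (setRows-≡ʳ i≢j M x x c)))

det-swapRows₀₁ : ∀ k (M : Mat (suc (suc k))) →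
  det (suc (suc k)) M + det (suc (suc k)) (swapRows zero (suc zero) M) ≡ 0ℤ
det-swapRows₀₁ k M = det-swapRows-of-alternating (suc (suc k)) M (λ ()) (det-equal-rows₀₁ k)

mutual
  det-equal-rows : ∀ k (M : Mat k) {i j : Fin k} → i ≢ j → (∀ c → M i c ≡ M j c) → det k M ≡ 0ℤ
  det-equal-rows (suc k) M {zero} {zero} i≢j _ = ⊥-elim (i≢j refl)
  det-equal-rows (suc k) M {suc i} {suc j} i≢j Mᵢ≡Mⱼ = det-equal-rows-below k M (i≢j ∘ cong suc) Mᵢ≡Mⱼ
  det-equal-rows (suc (suc k)) M {zero} {suc zero} _ M₀≡M₁ = det-equal-rows₀₁ k M M₀≡M₁
  det-equal-rows (suc (suc k)) M {suc zero} {zero} _ M₁≡M₀ = det-equal-rows₀₁ k M (sym ∘ M₁≡M₀)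
  det-equal-rows (suc (suc k)) M {zero} {suc (suc j)} _ M₀≡Mⱼ =
    det-equal-rows-via-swap₀₁ k M (det-equal-rows-below (suc k) (swapRows zero (suc zero) M) {zero} {suc j} (λ ()) M₀≡Mⱼ)
  det-equal-rows (suc (suc k)) M {suc (suc i)} {zero} _ Mᵢ≡M₀ =
    det-equal-rows-via-swap₀₁ k M (det-equal-rows-below (suc k) (swapRows zero (suc zero) M) {zero} {suc i} (λ ()) (sym ∘ Mᵢ≡M₀))

  det-equal-rows-below : ∀ k (M : Mat (suc k)) {i j : Fin k} → i ≢ j →
    (∀ c → M (suc i) c ≡ M (suc j) c) → det (suc k) M ≡ 0ℤ
  det-equal-rows-below k M i≢j Mᵢ≡Mⱼ = sumℤ-zero (laplaceTerm M) λ l →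
    trans (cong (λ d → sign l * (M zero l * d)) (det-equal-rows k (minor M l) i≢j (Mᵢ≡Mⱼ ∘ punchIn l)))
          (times-zero (sign l) (M zero l))
    where
    times-zero : ∀ s x → s * (x * 0ℤ) ≡ 0ℤ
    times-zero = solve-∀

  det-equal-rows-via-swap₀₁ : ∀ k (M : Mat (suc (suc k))) →
    det (suc (suc k)) (swapRows zero (suc zero) M) ≡ 0ℤ → det (suc (suc k)) M ≡ 0ℤ
  det-equal-rows-via-swap₀₁ k M swap≡0 =
    trans (sym (trans (cong (_+_ (det (suc (suc k)) M)) swap≡0) (ℤP.+-identityʳ _))) (det-swapRows₀₁ k M)

det-swapRows : ∀ k (M : Mat k) {i j} → i ≢ j → det k M + det k (swapRows i j M) ≡ 0ℤ
det-swapRows k M i≢j = det-swapRows-of-alternating k M i≢j (λ N → det-equal-rows k N i≢j)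

det-zero-column : ∀ k (M : Mat k) (f : Fin k) → (∀ r → M r f ≡ 0ℤ) → det k M ≡ 0ℤ
det-zero-column (suc k) M f column≡0 = sumℤ-zero (laplaceTerm M) term
  where
  times-zero : ∀ s x → s * (x * 0ℤ) ≡ 0ℤ
  times-zero = solve-∀
  term : ∀ j → laplaceTerm M j ≡ 0ℤ
  term j with j ≟ f
  ... | yes refl = trans (cong (λ x → sign j * (x * det k (minor M j))) (column≡0 zero))
                         (trans (cong (sign j *_) (ℤP.*-zeroˡ (det k (minor M j)))) (ℤP.*-zeroʳ (sign j)))
  ... | no j≢f = trans (cong (λ d → sign j * (M zero j * d))
                   (det-zero-column k (minor M j) (punchOut j≢f)
                     (λ r → trans (cong (M (suc r)) (FinP.punchIn-punchOut j≢f)) (column≡0 (suc r)))))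
                 (times-zero (sign j) (M zero j))

det-single-entry-column : ∀ k (M : Mat (suc k)) (f : Fin (suc k)) → (∀ r → M (suc r) f ≡ 0ℤ) →
  det (suc k) M ≡ sign f * (M zero f * det k (minor M f))
det-single-entry-column k M f below≡0 = sumℤ-single (laplaceTerm M) f term
  where
  times-zero : ∀ s x → s * (x * 0ℤ) ≡ 0ℤ
  times-zero = solve-∀
  term : ∀ j → j ≢ f → laplaceTerm M j ≡ 0ℤ
  term j j≢f = trans (cong (λ d → sign j * (M zero j * d))
                 (det-zero-column k (minor M j) (punchOut j≢f)
                   (λ r → trans (cong (M (suc r)) (FinP.punchIn-punchOut j≢f)) (below≡0 r))))
               (times-zero (sign j) (M zero j))

det-setRow-otherRow : ∀ k (M : Mat k) {i r : Fin k} → r ≢ i → det k (setRow i (M r) M) ≡ 0ℤ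
det-setRow-otherRow k M {i} {r} r≢i = det-equal-rows k (setRow i (M r) M) (r≢i ∘ sym)
  (λ c → trans (setRow-≡ i (M r) M c) (sym (setRow-≢ (M r) M c r≢i)))

det-setRow-self : ∀ k (M : Mat k) (i : Fin k) → det k (setRow i (M i) M) ≡ det k M
det-setRow-self k M i = det-cong k (setRow-self i M)

det-addRowMultiple : ∀ k (M : Mat k) {w u : Fin k} (a : ℤ) → w ≢ u →
  det k (setRow w (λ c → M w c + a * M u c) M) ≡ det k M
det-addRowMultiple k M {w} {u} a w≢u = begin
  det k (setRow w (λ c → M w c + a * M u c) M)
    ≡⟨ det-setRow-+ k M w (M w) (λ c → a * M u c) ⟩
  det k (setRow w (M w) M) + det k (setRow w (λ c → a * M u c) M)
    ≡⟨ cong₂ _+_ (det-setRow-self k M w) (det-setRow-* k M w a (M u)) ⟩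
  det k M + a * det k (setRow w (M u) M)
    ≡⟨ cong (λ d → det k M + a * d) (det-setRow-otherRow k M (w≢u ∘ sym)) ⟩
  det k M + a * 0ℤ
    ≡⟨ trans (cong (_+_ (det k M)) (ℤP.*-zeroʳ a)) (ℤP.+-identityʳ (det k M)) ⟩
  det k M ∎

det-setRow-sum : ∀ k l (M : Mat k) (i : Fin k) (F : Fin l → Fin k → ℤ) →
  det k (setRow i (λ c → sumℤ (λ t → F t c)) M) ≡ sumℤ (λ t → det k (setRow i (F t) M))
det-setRow-sum k zero    M i F = det-zero-row k _ i (setRow-≡ i (λ _ → 0ℤ) M)
det-setRow-sum k (suc l) M i F =
  trans (det-setRow-+ k M i (F zero) (λ c → sumℤ (λ t → F (suc t) c)))
        (cong (_+_ (det k (setRow i (F zero) M))) (det-setRow-sum k l M i (F ∘ suc)))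

det-setRow-combination : ∀ k (M : Mat k) (i : Fin k) (co : Fin k → ℤ) →
  det k (setRow i (λ c → sumℤ (λ r → co r * M r c)) M) ≡ co i * det k M
det-setRow-combination k M i co = begin
  det k (setRow i (λ c → sumℤ (λ r → co r * M r c)) M)
    ≡⟨ det-setRow-sum k k M i (λ r c → co r * M r c) ⟩
  sumℤ (λ r → det k (setRow i (λ c → co r * M r c) M))
    ≡⟨ sumℤ-cong (λ r → det-setRow-* k M i (co r) (M r)) ⟩
  sumℤ (λ r → co r * det k (setRow i (M r) M))
    ≡⟨ sumℤ-single _ i (λ r r≢i → trans (cong (co r *_) (det-setRow-otherRow k M r≢i)) (ℤP.*-zeroʳ (co r))) ⟩
  co i * det k (setRow i (M i) M)
    ≡⟨ cong (co i *_) (det-setRow-self k M i) ⟩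
  co i * det k M ∎

∣det-swapRows∣ : ∀ k (M : Mat k) (i j : Fin k) → ∣ det k (swapRows i j M) ∣ ≡ ∣ det k M ∣
∣det-swapRows∣ k M i j with i ≟ j
... | yes refl = cong ∣_∣ (det-cong k (λ r c → cong (λ t → M t c) (transpose-same i r)))
... | no i≢j   = trans (cong ∣_∣ (x+y≡0⇒y≡-x (det k M) (det k (swapRows i j M)) (det-swapRows k M i≢j))) (ℤP.∣-i∣≡∣i∣ (det k M))

det-setRow-cong : ∀ k (M : Mat k) (i : Fin k) {x y : Fin k → ℤ} → (∀ c → x c ≡ y c) →
  det k (setRow i x M) ≡ det k (setRow i y M)
det-setRow-cong k M i x≡y = det-cong k λ r c → cong (λ t → if does (r ≟ i) then t else M r c) (x≡y c)

-- Maximal minors of signed graphs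

choose-singleton : ∀ m (f : Fin m) → Σ (Fin 1 → Fin m) λ c → c ∈ choose 1 m × c zero ≡ f
choose-singleton (suc m) zero    = _ , ∈-++⁺ʳ (map _ (choose 1 m)) (here refl) , refl
choose-singleton (suc m) (suc f) with choose-singleton m f
... | c , c∈ , c₀≡f = _ , ∈-++⁺ˡ (∈-map⁺ _ c∈) , cong suc c₀≡f

choose-insert : ∀ K m (c′ : Fin K → Fin m) → c′ ∈ choose K m → (f : Fin (suc m)) →
  Σ (Fin (suc K) → Fin (suc m)) λ c → c ∈ choose (suc K) (suc m) ×
    Σ (Fin (suc K)) λ p → c p ≡ f × (∀ i → c (punchIn p i) ≡ punchIn f (c′ i))
choose-insert zero m c′ _ f with choose-singleton (suc m) f
... | c , c∈ , c₀≡f = c , c∈ , zero , c₀≡f , λ ()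
choose-insert (suc K) m c′ c′∈ zero =
  _ , ∈-++⁺ʳ (map _ (choose (suc (suc K)) m)) (∈-map⁺ _ c′∈) , zero , refl , λ _ → refl
choose-insert (suc K) (suc m) c′ c′∈ (suc f) with ∈-++⁻ (map _ (choose (suc K) m)) c′∈
... | inj₁ c′∈ˡ with ∈-map⁻ _ c′∈ˡ
...   | c″ , c″∈ , refl with choose-insert (suc K) m c″ c″∈ f
...     | c , c∈ , p , cₚ≡f , c∘punchIn =
  _ , ∈-++⁺ˡ (∈-map⁺ _ c∈) , p , cong suc cₚ≡f , cong suc ∘ c∘punchIn
choose-insert (suc K) (suc m) c′ c′∈ (suc f) | inj₂ c′∈ʳ with ∈-map⁻ _ c′∈ʳ
...   | c″ , c″∈ , refl with choose-insert K m c″ c″∈ f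
...     | c , c∈ , p , cₚ≡f , c∘punchIn =
  _ , ∈-++⁺ʳ (map _ (choose (suc (suc K)) (suc m))) (∈-map⁺ _ c∈) , suc p , cong suc cₚ≡f , shifted
  where
  shifted : ∀ i → _
  shifted zero    = refl
  shifted (suc i) = cong suc (c∘punchIn i)

pointMass : ∀ {K} → Fin K → ℤ → Fin K → ℤ
pointMass x e r = if does (x ≟ r) then e else 0ℤ

pointMass-≡ : ∀ {K} (x : Fin K) e → pointMass x e x ≡ e
pointMass-≡ x e with x ≟ x
... | yes _  = refl
... | no x≢x = ⊥-elim (x≢x refl)

pointMass-≢ : ∀ {K} {x r : Fin K} e → x ≢ r → pointMass x e r ≡ 0ℤ
pointMass-≢ {x = x} {r} e x≢r with x ≟ r
... | yes x≡r = ⊥-elim (x≢r x≡r)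
... | no _    = refl

pointMass-transport : ∀ {K K′} {x r : Fin K} {y s : Fin K′} e →
  (x ≡ r → y ≡ s) → (y ≡ s → x ≡ r) → pointMass x e r ≡ pointMass y e s
pointMass-transport {x = x} {r} {y} {s} e to from with x ≟ r | y ≟ s
... | yes _   | yes _   = refl
... | no _    | no _    = refl
... | yes x≡r | no y≢s  = ⊥-elim (y≢s (to x≡r))
... | no x≢r  | yes y≡s = ⊥-elim (x≢r (from y≡s))

-- Edge j joins α j and β j, carrying the signs a j and b j at its two ends.
record SignedGraph (K m : ℕ) : Set where
  field
    α β    : Fin m → Fin K
    a b    : Fin m → ℤ
    unit-a : ∀ j → Unit (a j)
    unit-b : ∀ j → Unit (b j)

module _ {K m} (S : SignedGraph K m) where
  open SignedGraph S

  incidence : Fin K → Fin m → ℤ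
  incidence r j = pointMass (α j) (a j) r + pointMass (β j) (b j) r

  Balanced : Set
  Balanced = Σ (Fin K → ℤ) λ ζ → (∀ r → Unit (ζ r)) × (∀ j → ζ (α j) * a j + ζ (β j) * b j ≡ 0ℤ)

  HasMinor±2 : Set
  HasMinor±2 = Σ (Fin K → Fin m) λ c → c ∈ choose K m × ∣ det K (λ r i → incidence r (c i)) ∣ ≡ 2

reach-distinct⇒nonLoop : ∀ {K m} {α β : Fin m → Fin K} {x y} → Reach α β x y → x ≢ y →
  Σ (Fin m) λ j → α j ≢ β j
reach-distinct⇒nonLoop here x≢x = ⊥-elim (x≢x refl)
reach-distinct⇒nonLoop {α = α} {β} (step (j , ends) W) x≢z with α j ≟ β j
... | no αⱼ≢βⱼ = j , αⱼ≢βⱼ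
... | yes αⱼ≡βⱼ = reach-distinct⇒nonLoop W (x≢z ∘ trans (loop-ends ends))
  where
  loop-ends : ∀ {x y} → (α j ≡ x × β j ≡ y) ⊎ (α j ≡ y × β j ≡ x) → x ≡ y
  loop-ends (inj₁ (αⱼ≡x , βⱼ≡y)) = trans (sym αⱼ≡x) (trans αⱼ≡βⱼ βⱼ≡y)
  loop-ends (inj₂ (αⱼ≡y , βⱼ≡x)) = trans (sym βⱼ≡x) (trans (sym αⱼ≡βⱼ) αⱼ≡y)

hasMinor±2-oneVertex : ∀ m (S : SignedGraph 1 m) → ¬ Balanced S → HasMinor±2 S
hasMinor±2-oneVertex m S unbalanced with FinP.¬∀⟶∃¬ m (λ j → a j + b j ≡ 0ℤ) (λ j → a j + b j ℤ.≟ 0ℤ) allZero⇒balanced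
  where
  open SignedGraph S
  allZero⇒balanced : ¬ (∀ j → a j + b j ≡ 0ℤ)
  allZero⇒balanced aⱼ+bⱼ≡0 = unbalanced ((λ _ → 1ℤ) , (λ _ → inj₁ refl) ,
    λ j → trans (cong₂ _+_ (ℤP.*-identityˡ (a j)) (ℤP.*-identityˡ (b j))) (aⱼ+bⱼ≡0 j))
... | j , aⱼ+bⱼ≢0 with choose-singleton m j
... | c , c∈ , c₀≡j = c , c∈ , (begin
  ∣ 1ℤ * (incidence S zero (c zero) * 1ℤ) + 0ℤ ∣
    ≡⟨ cong ∣_∣ (det₁ (incidence S zero (c zero))) ⟩
  ∣ incidence S zero (c zero) ∣
    ≡⟨ cong (λ i → ∣ incidence S zero i ∣) c₀≡j ⟩
  ∣ pointMass (α j) (a j) zero + pointMass (β j) (b j) zero ∣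
    ≡⟨ cong ∣_∣ (cong₂ _+_ (onlyVertex (α j) (a j)) (onlyVertex (β j) (b j))) ⟩
  ∣ a j + b j ∣
    ≡⟨ units-sum≢0⇒∣sum∣≡2 (unit-a j) (unit-b j) aⱼ+bⱼ≢0 ⟩
  2 ∎)
  where
  open SignedGraph S
  det₁ : ∀ x → 1ℤ * (x * 1ℤ) + 0ℤ ≡ x
  det₁ = solve-∀
  onlyVertex : ∀ (x : Fin 1) e → pointMass x e zero ≡ e
  onlyVertex zero e = refl

-- Contracting the edge f = (u, w): add κ times row u to row w so that column f keeps a
-- single entry, then expand along it. The remaining minor is the incidence matrix of the
-- signed graph in which u is merged into w and the signs at u are multiplied by κ.
module Contraction {k m′} (S : SignedGraph (suc (suc k)) (suc m′)) (f : Fin (suc m′))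
                   (f-nonLoop : SignedGraph.α S f ≢ SignedGraph.β S f) where
  open SignedGraph S

  u w : Fin (suc (suc k))
  u = α f
  w = β f

  w≢u : w ≢ u
  w≢u = f-nonLoop ∘ sym

  κ : ℤ
  κ = - (b f * a f)

  unit-κ : Unit κ
  unit-κ = unit-neg (unit-* (unit-b f) (unit-a f))

  vertexOf : Fin (suc k) → Fin (suc (suc k))
  vertexOf r = transpose zero u (suc r)

  vertexOf-≢u : ∀ r → vertexOf r ≢ u
  vertexOf-≢u r vᵣ≡u with trans (sym (transpose-inverse u zero {suc r})) (trans (cong (transpose u zero) vᵣ≡u) (transpose-self u zero))
  ... | ()

  private
    predecessor : Fin (suc (suc k)) → Fin (suc k)
    predecessor zero    = zero
    predecessor (suc x) = x

  rowOf : Fin (suc (suc k)) → Fin (suc k)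
  rowOf y = predecessor (transpose u zero y)

  rowOf-vertexOf : ∀ r → rowOf (vertexOf r) ≡ r
  rowOf-vertexOf r = cong predecessor (transpose-inverse u zero {suc r})

  vertexOf-rowOf : ∀ {y} → y ≢ u → ∀ {r} → rowOf y ≡ r → y ≡ vertexOf r
  vertexOf-rowOf {y} y≢u {r} rowOf≡r = begin
    y                                       ≡⟨ sym (transpose-inverse zero u {y}) ⟩
    transpose zero u (transpose u zero y)   ≡⟨ cong (transpose zero u) (nonzero (transpose u zero y) refl) ⟩
    transpose zero u (suc (rowOf y))        ≡⟨ cong vertexOf rowOf≡r ⟩
    vertexOf r                              ∎
    where
    nonzero : ∀ t → t ≡ transpose u zero y → t ≡ suc (predecessor t)
    nonzero zero    0≡ = ⊥-elim (y≢u (trans (sym (transpose-inverse zero u {y})) (cong (transpose zero u) (sym 0≡))))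
    nonzero (suc t) _  = refl

  merge : Fin (suc (suc k)) → Fin (suc k)
  merge x = rowOf (if does (x ≟ u) then w else x)

  merge-≢u : ∀ {x} → x ≢ u → merge x ≡ rowOf x
  merge-≢u {x} x≢u = cong rowOf (if-no (x ≟ u) x≢u)

  merge-u : merge u ≡ rowOf w
  merge-u = cong rowOf (if-yes (u ≟ u) refl)

  merge-vertexOf : ∀ r → merge (vertexOf r) ≡ r
  merge-vertexOf r = trans (merge-≢u (vertexOf-≢u r)) (rowOf-vertexOf r)

  rescale : Fin (suc (suc k)) → ℤ → ℤ
  rescale x e = if does (x ≟ u) then κ * e else e

  unit-rescale : ∀ x {e} → Unit e → Unit (rescale x e)
  unit-rescale x unit-e with x ≟ u
  ... | yes _ = unit-* unit-κ unit-e
  ... | no _  = unit-e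

  rescale-* : ∀ x z e → rescale x z * e ≡ z * rescale x e
  rescale-* x z e with x ≟ u
  ... | yes _ = reassoc κ z e
    where
    reassoc : ∀ l z e → (l * z) * e ≡ z * (l * e)
    reassoc = solve-∀
  ... | no _ = refl

  contracted : SignedGraph (suc k) m′
  contracted = record
    { α      = λ j → merge (α (punchIn f j))
    ; β      = λ j → merge (β (punchIn f j))
    ; a      = λ j → rescale (α (punchIn f j)) (a (punchIn f j))
    ; b      = λ j → rescale (β (punchIn f j)) (b (punchIn f j))
    ; unit-a = λ j → unit-rescale (α (punchIn f j)) (unit-a (punchIn f j))
    ; unit-b = λ j → unit-rescale (β (punchIn f j)) (unit-b (punchIn f j))
    }

  private
    module C = SignedGraph contracted

  reach-contracted : ∀ {x z} → Reach α β x z → Reach C.α C.β (merge x) (merge z)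
  reach-contracted here = here
  reach-contracted {x} {z} (step {b = y} (j , ends) W) with f ≟ j
  ... | yes refl = subst (λ t → Reach C.α C.β t (merge z)) (sym (merged ends)) (reach-contracted W)
    where
    merge-w : merge w ≡ rowOf w
    merge-w = merge-≢u w≢u
    merged : (α f ≡ x × β f ≡ y) ⊎ (α f ≡ y × β f ≡ x) → merge x ≡ merge y
    merged (inj₁ (refl , refl)) = trans merge-u (sym merge-w)
    merged (inj₂ (refl , refl)) = trans merge-w (sym merge-u)
  ... | no f≢j = step (punchOut f≢j , contractedEnds ends) (reach-contracted W)
    where
    j≡ : punchIn f (punchOut f≢j) ≡ j
    j≡ = FinP.punchIn-punchOut f≢j
    contractedEnds : (α j ≡ x × β j ≡ y) ⊎ (α j ≡ y × β j ≡ x) →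
      (C.α (punchOut f≢j) ≡ merge x × C.β (punchOut f≢j) ≡ merge y) ⊎
      (C.α (punchOut f≢j) ≡ merge y × C.β (punchOut f≢j) ≡ merge x)
    contractedEnds (inj₁ (αⱼ , βⱼ)) = inj₁ (cong merge (trans (cong α j≡) αⱼ) , cong merge (trans (cong β j≡) βⱼ))
    contractedEnds (inj₂ (αⱼ , βⱼ)) = inj₂ (cong merge (trans (cong α j≡) αⱼ) , cong merge (trans (cong β j≡) βⱼ))

  connected-contracted : Connected α β → Connected C.α C.β
  connected-contracted conn r r′ =
    subst₂ (Reach C.α C.β) (merge-vertexOf r) (merge-vertexOf r′) (reach-contracted (conn (vertexOf r) (vertexOf r′)))

  -- a switching of the contracted graph lifts by giving u the value of w, rescaled by κ
  unbalanced-contracted : ¬ Balanced S → ¬ Balanced contracted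
  unbalanced-contracted unbalanced (ζ′ , unit-ζ′ , balanced′) = unbalanced (ζ , unit-ζ , balanced)
    where
    ζ : Fin (suc (suc k)) → ℤ
    ζ x = rescale x (ζ′ (merge x))
    unit-ζ : ∀ x → Unit (ζ x)
    unit-ζ x = unit-rescale x (unit-ζ′ (merge x))
    endpoint : ∀ x e → ζ x * e ≡ ζ′ (merge x) * rescale x e
    endpoint x e = rescale-* x (ζ′ (merge x)) e
    edge-f : ∀ z → (κ * z) * a f + z * b f ≡ 0ℤ
    edge-f z = trans (factor (b f) (a f) z) (trans (cong (λ t → z * b f * (1ℤ - t)) (unit*self≡1 (unit-a f))) (times-zero (z * b f)))
      where
      factor : ∀ y x z → (- (y * x) * z) * x + z * y ≡ z * y * (1ℤ - x * x)
      factor = solve-∀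
      times-zero : ∀ t → t * (1ℤ - 1ℤ) ≡ 0ℤ
      times-zero = solve-∀
    balanced : ∀ j → ζ (α j) * a j + ζ (β j) * b j ≡ 0ℤ
    balanced j with f ≟ j
    ... | yes refl = trans (cong₂ (λ s t → s * a f + t * b f)
                             (trans (if-yes (u ≟ u) refl) (cong (λ r → κ * ζ′ r) merge-u))
                             (trans (if-no (w ≟ u) w≢u) (cong ζ′ (merge-≢u w≢u))))
                           (edge-f (ζ′ (rowOf w)))
    ... | no f≢j = begin
      ζ (α j) * a j + ζ (β j) * b j
        ≡⟨ cong₂ _+_ (endpoint (α j) (a j)) (endpoint (β j) (b j)) ⟩
      ζ′ (merge (α j)) * rescale (α j) (a j) + ζ′ (merge (β j)) * rescale (β j) (b j)
        ≡⟨ cong (λ t → ζ′ (merge (α t)) * rescale (α t) (a t) + ζ′ (merge (β t)) * rescale (β t) (b t))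
                (sym (FinP.punchIn-punchOut f≢j)) ⟩
      ζ′ (C.α (punchOut f≢j)) * C.a (punchOut f≢j) + ζ′ (C.β (punchOut f≢j)) * C.b (punchOut f≢j)
        ≡⟨ balanced′ (punchOut f≢j) ⟩
      0ℤ ∎

  reducedIncidence : Fin (suc (suc k)) → Fin (suc m′) → ℤ
  reducedIncidence v g = if does (v ≟ w) then incidence S w g + κ * incidence S u g else incidence S v g

  endpointRow : Fin (suc (suc k)) → Fin (suc (suc k)) → ℤ → ℤ
  endpointRow v x e = if does (v ≟ w) then pointMass x e w + κ * pointMass x e u else pointMass x e v

  reducedIncidence-endpoints : ∀ v g →
    reducedIncidence v g ≡ endpointRow v (α g) (a g) + endpointRow v (β g) (b g)
  reducedIncidence-endpoints v g with v ≟ w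
  ... | yes _ = distrib (pointMass (α g) (a g) w) (pointMass (β g) (b g) w) (pointMass (α g) (a g) u) (pointMass (β g) (b g) u) κ
    where
    distrib : ∀ x y x′ y′ l → (x + y) + l * (x′ + y′) ≡ (x + l * x′) + (y + l * y′)
    distrib = solve-∀
  ... | no _ = refl

  endpointRow-u : ∀ r e → endpointRow (vertexOf r) u e ≡ pointMass (rowOf w) (κ * e) r
  endpointRow-u r e with vertexOf r ≟ w
  ... | yes vᵣ≡w = begin
    pointMass u e w + κ * pointMass u e u ≡⟨ cong₂ (λ s t → s + κ * t) (pointMass-≢ e f-nonLoop) (pointMass-≡ u e) ⟩
    0ℤ + κ * e                            ≡⟨ ℤP.+-identityˡ (κ * e) ⟩
    κ * e                                 ≡⟨ sym (pointMass-≡ r (κ * e)) ⟩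
    pointMass r (κ * e) r                 ≡⟨ cong (λ t → pointMass t (κ * e) r) (sym (trans (cong rowOf (sym vᵣ≡w)) (rowOf-vertexOf r))) ⟩
    pointMass (rowOf w) (κ * e) r         ∎
  ... | no vᵣ≢w = trans (pointMass-≢ e (vertexOf-≢u r ∘ sym))
                        (sym (pointMass-≢ (κ * e) (vᵣ≢w ∘ sym ∘ vertexOf-rowOf w≢u)))

  endpointRow-≢u : ∀ r {x} e → x ≢ u → endpointRow (vertexOf r) x e ≡ pointMass (rowOf x) e r
  endpointRow-≢u r {x} e x≢u = trans away-from-u
    (pointMass-transport e (λ x≡vᵣ → trans (cong rowOf x≡vᵣ) (rowOf-vertexOf r)) (vertexOf-rowOf x≢u))
    where
    away-from-u : endpointRow (vertexOf r) x e ≡ pointMass x e (vertexOf r)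
    away-from-u with vertexOf r ≟ w
    ... | yes vᵣ≡w = begin
      pointMass x e w + κ * pointMass x e u ≡⟨ cong (λ t → pointMass x e w + κ * t) (pointMass-≢ e x≢u) ⟩
      pointMass x e w + κ * 0ℤ              ≡⟨ cong (_+_ (pointMass x e w)) (ℤP.*-zeroʳ κ) ⟩
      pointMass x e w + 0ℤ                  ≡⟨ ℤP.+-identityʳ (pointMass x e w) ⟩
      pointMass x e w                       ≡⟨ cong (pointMass x e) (sym vᵣ≡w) ⟩
      pointMass x e (vertexOf r)            ∎
    ... | no _ = refl

  endpointRow-contracted : ∀ r x e → endpointRow (vertexOf r) x e ≡ pointMass (merge x) (rescale x e) r
  endpointRow-contracted r x e = byCases (x ≟ u)
    where
    byCases : Dec (x ≡ u) → endpointRow (vertexOf r) x e ≡ pointMass (merge x) (rescale x e) r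
    byCases (yes refl) = trans (endpointRow-u r e)
      (cong₂ (λ t s → pointMass t s r) (sym merge-u) (sym (if-yes (u ≟ u) refl)))
    byCases (no x≢u) = trans (endpointRow-≢u r e x≢u)
      (cong₂ (λ t s → pointMass t s r) (sym (merge-≢u x≢u)) (sym (if-no (x ≟ u) x≢u)))

  reducedIncidence-contracted : ∀ r j → reducedIncidence (vertexOf r) (punchIn f j) ≡ incidence contracted r j
  reducedIncidence-contracted r j = trans (reducedIncidence-endpoints (vertexOf r) g)
    (cong₂ _+_ (endpointRow-contracted r (α g) (a g)) (endpointRow-contracted r (β g) (b g)))
    where
    g : Fin (suc m′)
    g = punchIn f j

  incidence-u-f : incidence S u f ≡ a f
  incidence-u-f = trans (cong₂ _+_ (pointMass-≡ u (a f)) (pointMass-≢ (b f) w≢u)) (ℤP.+-identityʳ (a f))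

  incidence-w-f : incidence S w f ≡ b f
  incidence-w-f = trans (cong₂ _+_ (pointMass-≢ (a f) f-nonLoop) (pointMass-≡ w (b f))) (ℤP.+-identityˡ (b f))

  reducedIncidence-f : ∀ r → reducedIncidence (vertexOf r) f ≡ 0ℤ
  reducedIncidence-f r with vertexOf r ≟ w
  ... | yes _ = begin
    incidence S w f + κ * incidence S u f ≡⟨ cong₂ (λ s t → s + κ * t) incidence-w-f incidence-u-f ⟩
    b f + κ * a f                         ≡⟨ factor (b f) (a f) ⟩
    b f * (1ℤ - a f * a f)                ≡⟨ cong (λ t → b f * (1ℤ - t)) (unit*self≡1 (unit-a f)) ⟩
    b f * (1ℤ - 1ℤ)                       ≡⟨ ℤP.*-zeroʳ (b f) ⟩
    0ℤ                                    ∎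
    where
    factor : ∀ y x → y + (- (y * x)) * x ≡ y * (1ℤ - x * x)
    factor = solve-∀
  ... | no vᵣ≢w = cong₂ _+_ (pointMass-≢ (a f) (vertexOf-≢u r ∘ sym)) (pointMass-≢ (b f) (vᵣ≢w ∘ sym))

  lift : HasMinor±2 contracted → HasMinor±2 S
  lift (c′ , c′∈ , ∣det′∣≡2) with choose-insert (suc k) m′ c′ c′∈ f
  ... | c , c∈ , p , cₚ≡f , c∘punchIn = c , c∈ , (begin
    ∣ det (suc (suc k)) M ∣
      ≡⟨ cong ∣_∣ (sym (det-addRowMultiple (suc (suc k)) M κ w≢u)) ⟩
    ∣ det (suc (suc k)) M₁ ∣
      ≡⟨ sym (∣det-swapRows∣ (suc (suc k)) M₁ zero u) ⟩
    ∣ det (suc (suc k)) M₂ ∣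
      ≡⟨ cong ∣_∣ (det-single-entry-column (suc k) M₂ p (λ r → trans (cong (reducedIncidence (vertexOf r)) cₚ≡f) (reducedIncidence-f r))) ⟩
    ∣ sign p * (M₂ zero p * det (suc k) (minor M₂ p)) ∣
      ≡⟨ cong₂ (λ x d → ∣ sign p * (x * d) ∣) M₂₀ₚ≡aᶠ (det-cong (suc k) minor≡contracted) ⟩
    ∣ sign p * (a f * D′) ∣
      ≡⟨ trans (ℤP.abs-* (sign p) (a f * D′)) (cong (ℕ._* ∣ a f * D′ ∣) (∣unit∣≡1 (unit-signℤ (toℕ p)))) ⟩
    1 ℕ.* ∣ a f * D′ ∣
      ≡⟨ trans (ℕP.*-identityˡ ∣ a f * D′ ∣) (ℤP.abs-* (a f) D′) ⟩
    ∣ a f ∣ ℕ.* ∣ D′ ∣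
      ≡⟨ cong₂ ℕ._*_ (∣unit∣≡1 (unit-a f)) ∣det′∣≡2 ⟩
    2 ∎)
    where
    M M₁ M₂ : Mat (suc (suc k))
    M r i = incidence S r (c i)
    M₁ = setRow w (λ i → M w i + κ * M u i) M
    M₂ = swapRows zero u M₁
    D′ : ℤ
    D′ = det (suc k) (λ r i → incidence contracted r (c′ i))
    M₂₀ₚ≡aᶠ : M₂ zero p ≡ a f
    M₂₀ₚ≡aᶠ = trans (setRow-≢ (λ i → M w i + κ * M u i) M p f-nonLoop) (trans (cong (incidence S u) cₚ≡f) incidence-u-f)
    minor≡contracted : ∀ r i → minor M₂ p r i ≡ incidence contracted r (c′ i)
    minor≡contracted r i = trans (cong (reducedIncidence (vertexOf r)) (c∘punchIn i)) (reducedIncidence-contracted r (c′ i))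

unbalanced⇒hasMinor±2 : ∀ k m (S : SignedGraph (suc k) m) →
  Connected (SignedGraph.α S) (SignedGraph.β S) → ¬ Balanced S → HasMinor±2 S
unbalanced⇒hasMinor±2 zero m S _ unbalanced = hasMinor±2-oneVertex m S unbalanced
unbalanced⇒hasMinor±2 (suc k) m S conn unbalanced with reach-distinct⇒nonLoop (conn zero (suc zero)) (λ ())
unbalanced⇒hasMinor±2 (suc k) (suc m′) S conn unbalanced | f , f-nonLoop =
  lift (unbalanced⇒hasMinor±2 k m′ contracted (connected-contracted conn) (unbalanced-contracted unbalanced))
  where
  open Contraction S f f-nonLoop

-- Congruences modulo d

module Mod (d : ℕ) .{{_ : NonZero d}} where

  infix 4 _≈_
  record _≈_ (x y : ℤ) : Set where
    constructor multipleOf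
    field
      quotient : ℤ
      difference : x - y ≡ quotient * + d

  ≈-refl : ∀ {x} → x ≈ x
  ≈-refl {x} = multipleOf 0ℤ (ℤP.+-inverseʳ x)

  ≡⇒≈ : ∀ {x y} → x ≡ y → x ≈ y
  ≡⇒≈ refl = ≈-refl

  ≈-sym : ∀ {x y} → x ≈ y → y ≈ x
  ≈-sym {x} {y} (multipleOf q x-y≡qd) = multipleOf (- q) (begin
    y - x       ≡⟨ flip x y ⟩
    - (x - y)   ≡⟨ cong -_ x-y≡qd ⟩
    - (q * + d) ≡⟨ ℤP.neg-distribˡ-* q (+ d) ⟩
    - q * + d   ∎)
    where
    flip : ∀ x y → y - x ≡ - (x - y)
    flip = solve-∀

  ≈-trans : ∀ {x y z} → x ≈ y → y ≈ z → x ≈ z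
  ≈-trans {x} {y} {z} (multipleOf q x-y≡qd) (multipleOf q′ y-z≡q′d) = multipleOf (q + q′) (begin
    x - z                ≡⟨ telescope x y z ⟩
    (x - y) + (y - z)    ≡⟨ cong₂ _+_ x-y≡qd y-z≡q′d ⟩
    q * + d + q′ * + d   ≡⟨ sym (ℤP.*-distribʳ-+ (+ d) q q′) ⟩
    (q + q′) * + d       ∎)
    where
    telescope : ∀ x y z → x - z ≡ (x - y) + (y - z)
    telescope = solve-∀

  ≈-setoid : Setoid 0ℓ 0ℓ
  ≈-setoid = record { Carrier = ℤ ; _≈_ = _≈_ ; isEquivalence = record { refl = ≈-refl ; sym = ≈-sym ; trans = ≈-trans } }

  open SetoidReasoning ≈-setoid public using (step-≈-⟩) renaming (begin_ to begin≈_; _∎ to _∎≈)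

  ≈-+ : ∀ {x y x′ y′} → x ≈ y → x′ ≈ y′ → x + x′ ≈ y + y′
  ≈-+ {x} {y} {x′} {y′} (multipleOf q x-y≡qd) (multipleOf q′ x′-y′≡q′d) = multipleOf (q + q′) (begin
    (x + x′) - (y + y′)   ≡⟨ regroup x y x′ y′ ⟩
    (x - y) + (x′ - y′)   ≡⟨ cong₂ _+_ x-y≡qd x′-y′≡q′d ⟩
    q * + d + q′ * + d    ≡⟨ sym (ℤP.*-distribʳ-+ (+ d) q q′) ⟩
    (q + q′) * + d        ∎)
    where
    regroup : ∀ x y x′ y′ → (x + x′) - (y + y′) ≡ (x - y) + (x′ - y′)
    regroup = solve-∀

  ≈-* : ∀ c {x y} → x ≈ y → c * x ≈ c * y
  ≈-* c {x} {y} (multipleOf q x-y≡qd) = multipleOf (c * q) (begin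
    c * x - c * y ≡⟨ factor c x y ⟩
    c * (x - y)   ≡⟨ cong (c *_) x-y≡qd ⟩
    c * (q * + d) ≡⟨ sym (ℤP.*-assoc c q (+ d)) ⟩
    c * q * + d   ∎)
    where
    factor : ∀ c x y → c * x - c * y ≡ c * (x - y)
    factor = solve-∀

  ≈-neg : ∀ {x y} → x ≈ y → - x ≈ - y
  ≈-neg {x} {y} x≈y with ≈-* -1ℤ x≈y
  ... | -x≈-y rewrite ℤP.-1*i≡-i x | ℤP.-1*i≡-i y = -x≈-y

  ≈-sum : ∀ {k} {f g : Fin k → ℤ} → (∀ i → f i ≈ g i) → sumℤ f ≈ sumℤ g
  ≈-sum {zero}  f≈g = ≈-refl
  ≈-sum {suc k} f≈g = ≈-+ (f≈g Fin.zero) (≈-sum (λ i → f≈g (Fin.suc i)))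

  multiple≈0 : ∀ q → q * + d ≈ 0ℤ
  multiple≈0 q = multipleOf q (ℤP.+-identityʳ (q * + d))

  x-y≈z⇒x≈z+y : ∀ a b c → a - b ≈ c → a ≈ c + b
  x-y≈z⇒x≈z+y a b c a-b≈c = ≈-trans (≡⇒≈ (shift a b)) (≈-+ a-b≈c (≈-refl {b}))
    where
    shift : ∀ a b → a ≡ (a - b) + b
    shift = solve-∀

  reduce : ℤ → Fin d
  reduce z = Fin.fromℕ< (n%ℕd<d z d)

  reduce-≈ : ∀ z → + toℕ (reduce z) ≈ z
  reduce-≈ z = multipleOf (- (z /ℕ d)) (begin
    + toℕ (reduce z) - z                        ≡⟨ cong₂ (λ s t → + s - t) (FinP.toℕ-fromℕ< (n%ℕd<d z d)) (a≡a%ℕn+[a/ℕn]*n z d) ⟩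
    + (z %ℕ d) - (+ (z %ℕ d) + (z /ℕ d) * + d)  ≡⟨ cancel (+ (z %ℕ d)) (z /ℕ d) (+ d) ⟩
    - (z /ℕ d) * + d                            ∎)
    where
    cancel : ∀ r q e → r - (r + q * e) ≡ - q * e
    cancel = solve-∀

  n≈n%d : ∀ n → + n ≈ + (n ℕ.% d)
  n≈n%d n = multipleOf (+ (n ℕ./ d)) (begin
    + n - + (n ℕ.% d)                                ≡⟨ cong (λ t → + t - + (n ℕ.% d)) (ℕD.m≡m%n+[m/n]*n n d) ⟩
    + (n ℕ.% d ℕ.+ n ℕ./ d ℕ.* d) - + (n ℕ.% d)      ≡⟨ cong (_- + (n ℕ.% d)) (trans (ℤP.pos-+ (n ℕ.% d) _) (cong (_+_ (+ (n ℕ.% d))) (ℤP.pos-* (n ℕ./ d) d))) ⟩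
    (+ (n ℕ.% d) + + (n ℕ./ d) * + d) - + (n ℕ.% d)  ≡⟨ cancel (+ (n ℕ.% d)) (+ (n ℕ./ d)) (+ d) ⟩
    + (n ℕ./ d) * + d                                ∎)
    where
    cancel : ∀ r q e → (r + q * e) - r ≡ q * e
    cancel = solve-∀

  private
    ≡+multiple : ∀ {m n} t → + m - + n ≡ + t * + d → m ≡ n ℕ.+ t ℕ.* d
    ≡+multiple {m} {n} t m-n≡td = ℤP.+-injective (begin
      + m                  ≡⟨ shift (+ m) (+ n) ⟩
      + n + (+ m - + n)    ≡⟨ cong (_+_ (+ n)) m-n≡td ⟩
      + n + + t * + d      ≡⟨ cong (_+_ (+ n)) (sym (ℤP.pos-* t d)) ⟩
      + n + + (t ℕ.* d)    ≡⟨ sym (ℤP.pos-+ n (t ℕ.* d)) ⟩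
      + (n ℕ.+ t ℕ.* d)    ∎)
      where
      shift : ∀ x y → x ≡ y + (x - y)
      shift = solve-∀

  ≈⇒%-≡ : ∀ m n → + m ≈ + n → m ℕ.% d ≡ n ℕ.% d
  ≈⇒%-≡ m n (multipleOf (+ t) m-n≡td) =
    trans (cong (ℕ._% d) (≡+multiple t m-n≡td)) (ℕD.[m+kn]%n≡m%n n t d)
  ≈⇒%-≡ m n (multipleOf -[1+ t ] m-n≡-td) =
    sym (trans (cong (ℕ._% d) (≡+multiple {n} {m} (suc t) n-m≡td)) (ℕD.[m+kn]%n≡m%n m (suc t) d))
    where
    n-m≡td : + n - + m ≡ + suc t * + d
    n-m≡td = begin
      + n - + m            ≡⟨ flip (+ m) (+ n) ⟩
      - (+ m - + n)        ≡⟨ cong -_ m-n≡-td ⟩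
      - (-[1+ t ] * + d)   ≡⟨ ℤP.neg-distribˡ-* -[1+ t ] (+ d) ⟩
      + suc t * + d        ∎
      where
      flip : ∀ x y → y - x ≡ - (x - y)
      flip = solve-∀

  ≈⇒≡ : ∀ {m n} → m ℕ.< d → n ℕ.< d → + m ≈ + n → m ≡ n
  ≈⇒≡ {m} {n} m<d n<d m≈n = trans (sym (ℕD.m<n⇒m%n≡m m<d)) (trans (≈⇒%-≡ m n m≈n) (ℕD.m<n⇒m%n≡m n<d))

  ≈⇒Fin-≡ : ∀ {i j : Fin d} → + toℕ i ≈ + toℕ j → i ≡ j
  ≈⇒Fin-≡ {i} {j} i≈j = FinP.toℕ-injective (≈⇒≡ (FinP.toℕ<n i) (FinP.toℕ<n j) i≈j)

  reduce-cong : ∀ {x y} → x ≈ y → reduce x ≡ reduce y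
  reduce-cong {x} {y} x≈y = ≈⇒Fin-≡ (≈-trans (reduce-≈ x) (≈-trans x≈y (≈-sym (reduce-≈ y))))

  %≡0⇒≈0 : ∀ n → n ℕ.% d ≡ 0 → + n ≈ 0ℤ
  %≡0⇒≈0 n n%d≡0 = ≈-trans (n≈n%d n) (≡⇒≈ (cong +_ n%d≡0))

  ≈0⇒%≡0 : ∀ n → + n ≈ 0ℤ → n ℕ.% d ≡ 0
  ≈0⇒%≡0 n n≈0 = trans (≈⇒%-≡ n 0 n≈0) (ℕD.m*n%n≡0 0 d)

  ≡%⇒≈ : ∀ y m n → y ≡ (m ℕ.+ n) ℕ.% d → + y ≈ + m + + n
  ≡%⇒≈ y m n y≡ = ≈-trans (≡⇒≈ (cong +_ y≡)) (≈-trans (≈-sym (n≈n%d (m ℕ.+ n))) (≡⇒≈ (ℤP.pos-+ m n)))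

  ≈⇒≡% : ∀ {y} m n → y ℕ.< d → + y ≈ + m + + n → y ≡ (m ℕ.+ n) ℕ.% d
  ≈⇒≡% {y} m n y<d y≈ = trans (sym (ℕD.m<n⇒m%n≡m y<d)) (≈⇒%-≡ y (m ℕ.+ n) (≈-trans y≈ (≡⇒≈ (sym (ℤP.pos-+ m n)))))

  2*≈0⇒≈0 : ∀ h → d ≡ suc (h ℕ.* 2) → ∀ e → + 2 * e ≈ 0ℤ → e ≈ 0ℤ
  2*≈0⇒≈0 h d≡2h+1 e (multipleOf r 2e≡rd) = multipleOf (e - + h * r) (begin
    e - 0ℤ                                ≡⟨ ℤP.+-identityʳ e ⟩
    e                                     ≡⟨ expand e (+ h) ⟩
    e * (1ℤ + + h * + 2) - + h * (+ 2 * e) ≡⟨ cong₂ (λ s t → e * s - + h * t) 2h+1≡d (trans (sym (ℤP.+-identityʳ (+ 2 * e))) 2e≡rd) ⟩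
    e * + d - + h * (r * + d)             ≡⟨ factor e (+ h) r (+ d) ⟩
    (e - + h * r) * + d                   ∎)
    where
    expand : ∀ e h → e ≡ e * (1ℤ + h * + 2) - h * (+ 2 * e)
    expand = solve-∀
    factor : ∀ e h r d → e * d - h * (r * d) ≡ (e - h * r) * d
    factor = solve-∀
    2h+1≡d : 1ℤ + + h * + 2 ≡ + d
    2h+1≡d = trans (cong (_+_ 1ℤ) (sym (ℤP.pos-* h 2))) (trans (sym (ℤP.pos-+ 1 (h ℕ.* 2))) (cong +_ (sym d≡2h+1)))

  -- with d = 2H, 2e ≡ r·d forces e = r·H, which is 0 or H mod d according to the parity of r
  2*≈0⇒≈0⊎≈half : ∀ h → d ≡ suc h ℕ.* 2 → ∀ e → + 2 * e ≈ 0ℤ → (e ≈ 0ℤ) ⊎ (e ≈ + suc h)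
  2*≈0⇒≈0⊎≈half h d≡2H e (multipleOf r 2e≡rd) = byParity (r %ℕ 2) (n%ℕd<d r 2) refl
    where
    H : ℤ
    H = + suc h
    d≡H*2 : + d ≡ H * + 2
    d≡H*2 = trans (cong +_ d≡2H) (ℤP.pos-* (suc h) 2)
    e≡rH : e ≡ r * H
    e≡rH = ℤP.*-cancelˡ-≡ (+ 2) e (r * H) (begin
      + 2 * e       ≡⟨ sym (ℤP.+-identityʳ (+ 2 * e)) ⟩
      + 2 * e - 0ℤ  ≡⟨ 2e≡rd ⟩
      r * + d       ≡⟨ cong (r *_) d≡H*2 ⟩
      r * (H * + 2) ≡⟨ reorder r H ⟩
      + 2 * (r * H) ∎)
      where
      reorder : ∀ r h → r * (h * + 2) ≡ + 2 * (r * h)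
      reorder = solve-∀
    r≡ : ∀ {k} → r %ℕ 2 ≡ k → r ≡ + k + (r /ℕ 2) * + 2
    r≡ {k} r%2≡k = trans (a≡a%ℕn+[a/ℕn]*n r 2) (cong (λ s → + s + (r /ℕ 2) * + 2) r%2≡k)
    byParity : ∀ k → k ℕ.< 2 → r %ℕ 2 ≡ k → (e ≈ 0ℤ) ⊎ (e ≈ H)
    byParity zero _ r%2≡0 = inj₁ (multipleOf (r /ℕ 2) (begin
      e - 0ℤ                     ≡⟨ trans (ℤP.+-identityʳ e) e≡rH ⟩
      r * H                      ≡⟨ cong (_* H) (r≡ r%2≡0) ⟩
      (0ℤ + (r /ℕ 2) * + 2) * H  ≡⟨ reorder (r /ℕ 2) H ⟩
      (r /ℕ 2) * (H * + 2)       ≡⟨ cong ((r /ℕ 2) *_) (sym d≡H*2) ⟩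
      (r /ℕ 2) * + d             ∎))
      where
      reorder : ∀ q h → (0ℤ + q * + 2) * h ≡ q * (h * + 2)
      reorder = solve-∀
    byParity (suc zero) _ r%2≡1 = inj₂ (multipleOf (r /ℕ 2) (begin
      e - H                          ≡⟨ cong (_- H) e≡rH ⟩
      r * H - H                      ≡⟨ cong (λ s → s * H - H) (r≡ r%2≡1) ⟩
      (1ℤ + (r /ℕ 2) * + 2) * H - H  ≡⟨ reorder (r /ℕ 2) H ⟩
      (r /ℕ 2) * (H * + 2)           ≡⟨ cong ((r /ℕ 2) *_) (sym d≡H*2) ⟩
      (r /ℕ 2) * + d                 ∎))
      where
      reorder : ∀ q h → (1ℤ + q * + 2) * h - h ≡ q * (h * + 2)
      reorder = solve-∀
    byParity (suc (suc k)) (ℕ.s≤s (ℕ.s≤s ())) _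

-- The incidence matrix of a connected graph

foldr-gcd-≡0 : ∀ (xs : List ℕ) → (∀ {x} → x ∈ xs → x ≡ 0) → foldr gcd 0 xs ≡ 0
foldr-gcd-≡0 []       _   = refl
foldr-gcd-≡0 (x ∷ xs) all0 =
  trans (cong₂ gcd (all0 (here refl)) (foldr-gcd-≡0 xs (all0 ∘ there))) gcd[0,0]≡0

∣-foldr-gcd : ∀ (xs : List ℕ) {k} → (∀ {x} → x ∈ xs → k ∣ x) → k ∣ foldr gcd 0 xs
∣-foldr-gcd []       {k} _      = k ∣0
∣-foldr-gcd (x ∷ xs)     k∣all = gcd-greatest (k∣all (here refl)) (∣-foldr-gcd xs (k∣all ∘ there))

foldr-gcd-∣ : ∀ (xs : List ℕ) {x} → x ∈ xs → foldr gcd 0 xs ∣ x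
foldr-gcd-∣ (x ∷ xs)  (here refl) = gcd[m,n]∣m x (foldr gcd 0 xs)
foldr-gcd-∣ (x₀ ∷ xs) (there x∈)  = ∣-trans (gcd[m,n]∣n x₀ (foldr gcd 0 xs)) (foldr-gcd-∣ xs x∈)

∈-map-∀ : ∀ {A : Set} (f : A → ℕ) {xs : List A} {P : ℕ → Set} → (∀ a → P (f a)) → ∀ {x} → x ∈ map f xs → P x
∈-map-∀ f Pf x∈ with ∈-map⁻ f x∈
... | a , _ , refl = Pf a

module Graph {n′ m : ℕ} (src tgt : Fin m → Fin (suc n′)) (loopless : Loopless src tgt)
             (connected : Connected src tgt) where

  V : Set
  V = Fin (suc n′)

  incℤ-δ : ∀ v j → incℤ src tgt v j ≡ δ v (src j) + δ v (tgt j)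
  incℤ-δ v j with v ≟ src j | v ≟ tgt j
  ... | yes v≡s | yes v≡t = ⊥-elim (loopless j (trans (sym v≡s) v≡t))
  ... | yes _   | no _    = refl
  ... | no _    | yes _   = refl
  ... | no _    | no _    = refl

  column-combination : ∀ (z : V → ℤ) j → sumℤ (λ v → z v * incℤ src tgt v j) ≡ z (src j) + z (tgt j)
  column-combination z j = begin
    sumℤ (λ v → z v * incℤ src tgt v j)
      ≡⟨ sumℤ-cong (λ v → trans (cong (z v *_) (incℤ-δ v j)) (ℤP.*-distribˡ-+ (z v) (δ v (src j)) (δ v (tgt j)))) ⟩
    sumℤ (λ v → z v * δ v (src j) + z v * δ v (tgt j))
      ≡⟨ sumℤ-+ (λ v → z v * δ v (src j)) (λ v → z v * δ v (tgt j)) ⟩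
    sumℤ (λ v → z v * δ v (src j)) + sumℤ (λ v → z v * δ v (tgt j))
      ≡⟨ cong₂ _+_ (sumℤ-δʳ (src j) z) (sumℤ-δʳ (tgt j) z) ⟩
    z (src j) + z (tgt j) ∎

  A· : (Fin m → ℤ) → V → ℤ
  A· u v = sumℤ (λ j → incℤ src tgt v j * u j)

  -- B u z is the bilinear form zᵀ A_G u
  B : (Fin m → ℤ) → (V → ℤ) → ℤ
  B u z = sumℤ (λ j → u j * (z (src j) + z (tgt j)))

  B-cong : ∀ {u u′} z → (∀ j → u j ≡ u′ j) → B u z ≡ B u′ z
  B-cong z u≡u′ = sumℤ-cong (λ j → cong (_* _) (u≡u′ j))

  B-+ : ∀ u u′ z → B (λ j → u j + u′ j) z ≡ B u z + B u′ z
  B-+ u u′ z = trans (sumℤ-cong (λ j → ℤP.*-distribʳ-+ _ (u j) (u′ j)))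
    (sumℤ-+ (λ j → u j * (z (src j) + z (tgt j))) (λ j → u′ j * (z (src j) + z (tgt j))))

  B-* : ∀ c u z → B (λ j → c * u j) z ≡ c * B u z
  B-* c u z = trans (sumℤ-cong (λ j → ℤP.*-assoc c (u j) _)) (sumℤ-* c (λ j → u j * (z (src j) + z (tgt j))))

  B-δ : ∀ j z → B (δ j) z ≡ z (src j) + z (tgt j)
  B-δ j z = sumℤ-δ j (λ i → z (src i) + z (tgt i))

  B-expand : ∀ u z → B u z ≡ sumℤ (λ v → z v * A· u v)
  B-expand u z = begin
    sumℤ (λ j → u j * (z (src j) + z (tgt j)))
      ≡⟨ sumℤ-cong (λ j → trans (cong (u j *_) (sym (column-combination z j))) (sym (sumℤ-* (u j) (λ v → z v * incℤ src tgt v j)))) ⟩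
    sumℤ (λ j → sumℤ (λ v → u j * (z v * incℤ src tgt v j)))
      ≡⟨ sumℤ-swap (λ j v → u j * (z v * incℤ src tgt v j)) ⟩
    sumℤ (λ v → sumℤ (λ j → u j * (z v * incℤ src tgt v j)))
      ≡⟨ sumℤ-cong (λ v → trans (sumℤ-cong (λ j → reorder (u j) (z v) (incℤ src tgt v j))) (sumℤ-* (z v) (λ j → incℤ src tgt v j * u j))) ⟩
    sumℤ (λ v → z v * A· u v) ∎
    where
    reorder : ∀ x y a → x * (y * a) ≡ y * (a * x)
    reorder = solve-∀

  B-δᵛ : ∀ u v → B u (δ v) ≡ A· u v
  B-δᵛ u v = sumℤ-cong (λ j → trans (ℤP.*-comm (u j) _) (cong (_* u j) (sym (incℤ-δ v j))))

  walkVector : ∀ {a b} → Reach src tgt a b → Fin m → ℤ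
  walkVector here                 = λ _ → 0ℤ
  walkVector (step (j , _) W) i = δ j i - walkVector W i

  walkSign : ∀ {a b} → Reach src tgt a b → ℤ
  walkSign here       = 1ℤ
  walkSign (step _ W) = - walkSign W

  unit-walkSign : ∀ {a b} (W : Reach src tgt a b) → Unit (walkSign W)
  unit-walkSign here       = inj₁ refl
  unit-walkSign (step _ W) = unit-neg (unit-walkSign W)

  B-walkVector : ∀ {a b} (W : Reach src tgt a b) z → B (walkVector W) z ≡ z a - walkSign W * z b
  B-walkVector {a} here z = begin
    sumℤ (λ j → 0ℤ * (z (src j) + z (tgt j))) ≡⟨ sumℤ-zero _ (λ j → ℤP.*-zeroˡ (z (src j) + z (tgt j))) ⟩
    0ℤ                                         ≡⟨ sym (ℤP.+-inverseʳ (z a)) ⟩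
    z a - z a                                  ≡⟨ cong (λ t → z a - t) (sym (ℤP.*-identityˡ (z a))) ⟩
    z a - 1ℤ * z a                             ∎
  B-walkVector {a} {c} (step {b = b} (j , ends) W) z = begin
    B (λ i → δ j i - walkVector W i) z
      ≡⟨ B-+ (δ j) (λ i → - walkVector W i) z ⟩
    B (δ j) z + B (λ i → - walkVector W i) z
      ≡⟨ cong₂ _+_ (trans (B-δ j z) (endpoints ends))
                   (trans (B-cong z (λ i → sym (ℤP.-1*i≡-i (walkVector W i)))) (B-* -1ℤ (walkVector W) z)) ⟩
    (z a + z b) + -1ℤ * B (walkVector W) z
      ≡⟨ cong (λ t → (z a + z b) + -1ℤ * t) (B-walkVector W z) ⟩
    (z a + z b) + -1ℤ * (z b - walkSign W * z c)
      ≡⟨ simplify (z a) (z b) (walkSign W) (z c) ⟩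
    z a - (- walkSign W) * z c ∎
    where
    simplify : ∀ x y s w → (x + y) + -1ℤ * (y - s * w) ≡ x - (- s) * w
    simplify = solve-∀
    endpoints : (src j ≡ a × tgt j ≡ b) ⊎ (src j ≡ b × tgt j ≡ a) → z (src j) + z (tgt j) ≡ z a + z b
    endpoints (inj₁ (refl , refl)) = refl
    endpoints (inj₂ (refl , refl)) = ℤP.+-comm (z b) (z a)

  walkFrom₀ : ∀ v → Reach src tgt zero v
  walkFrom₀ zero    = here
  walkFrom₀ (suc v) = connected zero (suc v)

  σ : V → ℤ
  σ v = walkSign (walkFrom₀ v)

  unit-σ : ∀ v → Unit (σ v)
  unit-σ v = unit-walkSign (walkFrom₀ v)

  ψ : V → Fin m → ℤ
  ψ v = walkVector (walkFrom₀ v)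

  B-ψ : ∀ v z → B (ψ v) z ≡ z zero - σ v * z v
  B-ψ v = B-walkVector (walkFrom₀ v)

  -- the closed walk 0 ⇝ src j → tgt j ⇝ 0
  cycleVector : Fin m → Fin m → ℤ
  cycleVector j i = (σ (src j) * ψ (src j) i + σ (tgt j) * ψ (tgt j) i) + δ j i

  B-cycleVector : ∀ j z → B (cycleVector j) z ≡ (σ (src j) + σ (tgt j)) * z zero
  B-cycleVector j z = begin
    B (cycleVector j) z
      ≡⟨ B-+ (λ i → σ s * ψ s i + σ t * ψ t i) (δ j) z ⟩
    B (λ i → σ s * ψ s i + σ t * ψ t i) z + B (δ j) z
      ≡⟨ cong₂ _+_ (trans (B-+ (λ i → σ s * ψ s i) (λ i → σ t * ψ t i) z)
                     (cong₂ _+_ (trans (B-* (σ s) (ψ s) z) (cong (σ s *_) (B-ψ s z)))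
                                (trans (B-* (σ t) (ψ t) z) (cong (σ t *_) (B-ψ t z)))))
                   (B-δ j z) ⟩
    (σ s * (z zero - σ s * z s) + σ t * (z zero - σ t * z t)) + (z s + z t)
      ≡⟨ expand (σ s) (σ t) (z zero) (z s) (z t) ⟩
    (σ s + σ t) * z zero + ((1ℤ - σ s * σ s) * z s + (1ℤ - σ t * σ t) * z t)
      ≡⟨ cong₂ (λ x y → (σ s + σ t) * z zero + ((1ℤ - x) * z s + (1ℤ - y) * z t))
               (unit*self≡1 (unit-σ s)) (unit*self≡1 (unit-σ t)) ⟩
    (σ s + σ t) * z zero + ((1ℤ - 1ℤ) * z s + (1ℤ - 1ℤ) * z t)
      ≡⟨ drop (σ s + σ t) (z zero) (z s) (z t) ⟩
    (σ s + σ t) * z zero ∎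
    where
    s t : V
    s = src j
    t = tgt j
    expand : ∀ p q z₀ x y → (p * (z₀ - p * x) + q * (z₀ - q * y)) + (x + y)
                          ≡ (p + q) * z₀ + ((1ℤ - p * p) * x + (1ℤ - q * q) * y)
    expand = solve-∀
    drop : ∀ a z₀ x y → a * z₀ + ((1ℤ - 1ℤ) * x + (1ℤ - 1ℤ) * y) ≡ a * z₀
    drop = solve-∀

  Bipartite : Set
  Bipartite = ∀ j → σ (src j) + σ (tgt j) ≡ 0ℤ

  bipartite⊎oddEdge : Bipartite ⊎ (Σ (Fin m) λ j → σ (src j) + σ (tgt j) ≢ 0ℤ)
  bipartite⊎oddEdge with FinP.all? (λ j → σ (src j) + σ (tgt j) ℤ.≟ 0ℤ)
  ... | yes bipartite  = inj₁ bipartite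
  ... | no ¬bipartite = inj₂ (FinP.¬∀⟶∃¬ m _ (λ j → σ (src j) + σ (tgt j) ℤ.≟ 0ℤ) ¬bipartite)

  B-annihilated : ∀ u {z} → (∀ j → z (src j) + z (tgt j) ≡ 0ℤ) → B u z ≡ 0ℤ
  B-annihilated u {z} z-odd = sumℤ-zero _ (λ j → trans (cong (u j *_) (z-odd j)) (ℤP.*-zeroʳ (u j)))

  -- a ±1 switching that is odd on every edge agrees with σ up to the global sign ζ 0
  switching⇒bipartite : ∀ (ζ : V → ℤ) → (∀ v → Unit (ζ v)) → (∀ j → ζ (src j) + ζ (tgt j) ≡ 0ℤ) → Bipartite
  switching⇒bipartite ζ unit-ζ ζ-odd j = begin
    σ s + σ t                    ≡⟨ cong₂ _+_ (σ≡ s) (σ≡ t) ⟩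
    ζ zero * ζ s + ζ zero * ζ t  ≡⟨ sym (ℤP.*-distribˡ-+ (ζ zero) (ζ s) (ζ t)) ⟩
    ζ zero * (ζ s + ζ t)         ≡⟨ cong (ζ zero *_) (ζ-odd j) ⟩
    ζ zero * 0ℤ                  ≡⟨ ℤP.*-zeroʳ (ζ zero) ⟩
    0ℤ                           ∎
    where
    s t : V
    s = src j
    t = tgt j
    ζ₀≡σζ : ∀ v → ζ zero ≡ σ v * ζ v
    ζ₀≡σζ v = ℤP.i-j≡0⇒i≡j (ζ zero) (σ v * ζ v) (trans (sym (B-ψ v ζ)) (B-annihilated (ψ v) {ζ} ζ-odd))
    σ≡ : ∀ v → σ v ≡ ζ zero * ζ v
    σ≡ v = sym (begin
      ζ zero * ζ v          ≡⟨ cong (_* ζ v) (ζ₀≡σζ v) ⟩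
      (σ v * ζ v) * ζ v     ≡⟨ ℤP.*-assoc (σ v) (ζ v) (ζ v) ⟩
      σ v * (ζ v * ζ v)     ≡⟨ cong (σ v *_) (unit*self≡1 (unit-ζ v)) ⟩
      σ v * 1ℤ              ≡⟨ ℤP.*-identityʳ (σ v) ⟩
      σ v                   ∎)

  incidenceMinor : (Fin (suc n′) → Fin m) → Mat (suc n′)
  incidenceMinor c r i = incℤ src tgt r (c i)

  det-incidenceMinor-switching : ∀ (z : V → ℤ) → z zero ≡ 1ℤ → (∀ j → z (src j) + z (tgt j) ≡ 0ℤ) →
    ∀ c → det (suc n′) (incidenceMinor c) ≡ 0ℤ
  det-incidenceMinor-switching z z₀≡1 z-odd c = begin
    det (suc n′) M                                                    ≡⟨ sym (ℤP.*-identityˡ _) ⟩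
    1ℤ * det (suc n′) M                                               ≡⟨ cong (_* det (suc n′) M) (sym z₀≡1) ⟩
    z zero * det (suc n′) M                                           ≡⟨ sym (det-setRow-combination (suc n′) M zero z) ⟩
    det (suc n′) (setRow zero (λ i → sumℤ (λ r → z r * M r i)) M)     ≡⟨ det-setRow-cong (suc n′) M zero (λ i → trans (column-combination z (c i)) (z-odd (c i))) ⟩
    det (suc n′) (setRow zero (λ _ → 0ℤ) M)                           ≡⟨ det-zero-row (suc n′) (setRow zero (λ _ → 0ℤ) M) zero (setRow-≡ zero (λ _ → 0ℤ) M) ⟩
    0ℤ                                                                ∎
    where
    M : Mat (suc n′)
    M = incidenceMinor c

  -- the rows of the incidence matrix sum to the all-twos row
  2∣det-incidenceMinor : ∀ c → 2 ∣ ∣ det (suc n′) (incidenceMinor c) ∣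
  2∣det-incidenceMinor c = divides ∣ D ∣ (begin
    ∣ det (suc n′) M ∣ ≡⟨ cong ∣_∣ det≡2D ⟩
    ∣ + 2 * D ∣        ≡⟨ ℤP.abs-* (+ 2) D ⟩
    2 ℕ.* ∣ D ∣        ≡⟨ ℕP.*-comm 2 ∣ D ∣ ⟩
    ∣ D ∣ ℕ.* 2        ∎)
    where
    M : Mat (suc n′)
    M = incidenceMinor c
    D : ℤ
    D = det (suc n′) (setRow zero (λ _ → 1ℤ) M)
    det≡2D : det (suc n′) M ≡ + 2 * D
    det≡2D = begin
      det (suc n′) M                                                  ≡⟨ sym (ℤP.*-identityˡ _) ⟩
      1ℤ * det (suc n′) M                                             ≡⟨ sym (det-setRow-combination (suc n′) M zero (λ _ → 1ℤ)) ⟩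
      det (suc n′) (setRow zero (λ i → sumℤ (λ r → 1ℤ * M r i)) M)    ≡⟨ det-setRow-cong (suc n′) M zero (λ i → column-combination (λ _ → 1ℤ) (c i)) ⟩
      det (suc n′) (setRow zero (λ _ → + 2 * 1ℤ) M)                   ≡⟨ det-setRow-* (suc n′) M zero (+ 2) (λ _ → 1ℤ) ⟩
      + 2 * D                                                         ∎

  minorList : List ℕ
  minorList = map (λ c → ∣ det (suc n′) (incidenceMinor c) ∣) (choose (suc n′) m)

  gMinors≡0 : Bipartite → gMinors src tgt ≡ 0
  gMinors≡0 bipartite = foldr-gcd-≡0 minorList
    (∈-map-∀ (λ c → ∣ det (suc n′) (incidenceMinor c) ∣) (λ c → cong ∣_∣ (det-incidenceMinor-switching σ refl bipartite c)))

  2∣gMinors : 2 ∣ gMinors src tgt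
  2∣gMinors = ∣-foldr-gcd minorList (∈-map-∀ (λ c → ∣ det (suc n′) (incidenceMinor c) ∣) 2∣det-incidenceMinor)

  asSignedGraph : SignedGraph (suc n′) m
  asSignedGraph = record
    { α = src ; β = tgt ; a = λ _ → 1ℤ ; b = λ _ → 1ℤ ; unit-a = λ _ → inj₁ refl ; unit-b = λ _ → inj₁ refl }

  incidence-asSignedGraph : ∀ r j → incidence asSignedGraph r j ≡ incℤ src tgt r j
  incidence-asSignedGraph r j = trans (cong₂ _+_ (δ-sym (src j) r) (δ-sym (tgt j) r)) (sym (incℤ-δ r j))

  oddEdge⇒unbalanced : ∀ {j} → σ (src j) + σ (tgt j) ≢ 0ℤ → ¬ Balanced asSignedGraph
  oddEdge⇒unbalanced {j} odd (ζ , unit-ζ , balanced) = odd (switching⇒bipartite ζ unit-ζ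
    (λ j → trans (sym (cong₂ _+_ (ℤP.*-identityʳ (ζ (src j))) (ℤP.*-identityʳ (ζ (tgt j))))) (balanced j)) j)

  gMinors≡2 : ∀ {j} → σ (src j) + σ (tgt j) ≢ 0ℤ → gMinors src tgt ≡ 2
  gMinors≡2 odd with unbalanced⇒hasMinor±2 n′ m asSignedGraph connected (oddEdge⇒unbalanced odd)
  ... | c , c∈ , ∣det∣≡2 = ∣-antisym (subst (gMinors src tgt ∣_) ∣det∣≡2′ (foldr-gcd-∣ minorList (∈-map⁺ (λ c → ∣ det (suc n′) (incidenceMinor c) ∣) c∈))) 2∣gMinors
    where
    ∣det∣≡2′ : ∣ det (suc n′) (incidenceMinor c) ∣ ≡ 2
    ∣det∣≡2′ = trans (cong ∣_∣ (det-cong (suc n′) (λ r i → sym (incidence-asSignedGraph r (c i))))) ∣det∣≡2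

  oddCycleVector : Fin m → Fin m → ℤ
  oddCycleVector j i = σ (src j) * cycleVector j i

  B-oddCycleVector : ∀ j → σ (tgt j) ≡ σ (src j) → ∀ z → B (oddCycleVector j) z ≡ + 2 * z zero
  B-oddCycleVector j σt≡σs z = begin
    B (oddCycleVector j) z                 ≡⟨ B-* (σ (src j)) (cycleVector j) z ⟩
    σ (src j) * B (cycleVector j) z        ≡⟨ cong (σ (src j) *_) (B-cycleVector j z) ⟩
    σ (src j) * ((σ (src j) + σ (tgt j)) * z zero) ≡⟨ cong (λ s → σ (src j) * ((σ (src j) + s) * z zero)) σt≡σs ⟩
    σ (src j) * ((σ (src j) + σ (src j)) * z zero) ≡⟨ expand (σ (src j)) (z zero) ⟩
    (σ (src j) * σ (src j) + σ (src j) * σ (src j)) * z zero ≡⟨ cong (λ s → (s + s) * z zero) (unit*self≡1 (unit-σ (src j))) ⟩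
    + 2 * z zero                           ∎
    where
    expand : ∀ q z → q * ((q + q) * z) ≡ (q * q + q * q) * z
    expand = solve-∀

-- Solutions of y_e = x_u x_w

module Solutions (d : ℕ) .{{_ : NonZero d}} {n′ m} (src tgt : Fin m → Fin (suc n′))
                 (loopless : Loopless src tgt) (connected : Connected src tgt) (y : Fin m → Fin d) where
  open Mod d
  open Graph src tgt loopless connected

  yℤ : Fin m → ℤ
  yℤ j = + toℕ (y j)

  -- y^u = ζ^(exponent u) for ζ = e^{2πi/d}
  exponent : (Fin m → ℤ) → ℤ
  exponent u = sumℤ (λ j → u j * yℤ j)

  exponent-+ : ∀ u u′ → exponent (λ j → u j + u′ j) ≡ exponent u + exponent u′
  exponent-+ u u′ = trans (sumℤ-cong (λ j → ℤP.*-distribʳ-+ (yℤ j) (u j) (u′ j)))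
    (sumℤ-+ (λ j → u j * yℤ j) (λ j → u′ j * yℤ j))

  exponent-* : ∀ c u → exponent (λ j → c * u j) ≡ c * exponent u
  exponent-* c u = trans (sumℤ-cong (λ j → ℤP.*-assoc c (u j) (yℤ j))) (sumℤ-* c (λ j → u j * yℤ j))

  exponent-δ : ∀ j → exponent (δ j) ≡ yℤ j
  exponent-δ j = sumℤ-δ j yℤ

  exponent-≈ : ∀ {u u′} → (∀ j → u j ≈ u′ j) → exponent u ≈ exponent u′
  exponent-≈ {u} {u′} u≈u′ = ≈-sum (λ j → ≈-trans (≡⇒≈ (ℤP.*-comm (u j) (yℤ j)))
    (≈-trans (≈-* (yℤ j) (u≈u′ j)) (≡⇒≈ (ℤP.*-comm (yℤ j) (u′ j)))))

  A·-≈ : ∀ {u u′} → (∀ j → u j ≈ u′ j) → ∀ v → A· u v ≈ A· u′ v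
  A·-≈ u≈u′ v = ≈-sum (λ j → ≈-* (incℤ src tgt v j) (u≈u′ j))

  toℤ : (Fin m → Fin d) → Fin m → ℤ
  toℤ u j = + toℕ (u j)

  inKer⇔ : ∀ u → (InKer src tgt u → ∀ v → A· (toℤ u) v ≈ 0ℤ) × ((∀ v → A· (toℤ u) v ≈ 0ℤ) → InKer src tgt u)
  inKer⇔ u = (λ inKer v → ≈-trans (≡⇒≈ (sym (A·≡ v))) (%≡0⇒≈0 _ (inKer v)))
           , (λ A·u≈0 v → ≈0⇒%≡0 _ (≈-trans (≡⇒≈ (A·≡ v)) (A·u≈0 v)))
    where
    A·≡ : ∀ v → + sumℕ (λ j → incℕ src tgt v j ℕ.* toℕ (u j)) ≡ A· (toℤ u) v
    A·≡ v = trans (sumℕ-toℤ (λ j → incℕ src tgt v j ℕ.* toℕ (u j))) (sumℤ-cong (λ j → ℤP.pos-* (incℕ src tgt v j) (toℕ (u j))))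

  powIsOne⇔ : ∀ u → (PowIsOne y u → exponent (toℤ u) ≈ 0ℤ) × (exponent (toℤ u) ≈ 0ℤ → PowIsOne y u)
  powIsOne⇔ u = (λ pow → ≈-trans (≡⇒≈ (sym exponent≡)) (%≡0⇒≈0 _ pow))
              , (λ exp≈0 → ≈0⇒%≡0 _ (≈-trans (≡⇒≈ exponent≡) exp≈0))
    where
    exponent≡ : + sumℕ (λ j → toℕ (u j) ℕ.* toℕ (y j)) ≡ exponent (toℤ u)
    exponent≡ = trans (sumℕ-toℤ (λ j → toℕ (u j) ℕ.* toℕ (y j))) (sumℤ-cong (λ j → ℤP.pos-* (toℕ (u j)) (toℕ (y j))))

  KernelCondition : Set
  KernelCondition = ∀ (u : Fin m → Fin d) → InKer src tgt u → PowIsOne y u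

  kernelCondition-ℤ : KernelCondition → ∀ u → (∀ v → A· u v ≈ 0ℤ) → exponent u ≈ 0ℤ
  kernelCondition-ℤ kernel u A·u≈0 =
    ≈-trans (exponent-≈ (λ j → ≈-sym (reduce-≈ (u j))))
            (Σ.proj₁ (powIsOne⇔ ū) (kernel ū (Σ.proj₂ (inKer⇔ ū) (λ v → ≈-trans (A·-≈ (λ j → reduce-≈ (u j)) v) (A·u≈0 v)))))
    where
    ū : Fin m → Fin d
    ū j = reduce (u j)

  xℤ : Vec (Fin d) (suc n′) → V → ℤ
  xℤ x v = + toℕ (lookup x v)

  isSol⇒≈ : ∀ {x} → IsSol src tgt y x → ∀ j → yℤ j ≈ xℤ x (src j) + xℤ x (tgt j)
  isSol⇒≈ {x} sol j = ≡%⇒≈ (toℕ (y j)) (toℕ (lookup x (src j))) (toℕ (lookup x (tgt j))) (sol j)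

  ≈⇒isSol : ∀ {x} → (∀ j → yℤ j ≈ xℤ x (src j) + xℤ x (tgt j)) → IsSol src tgt y x
  ≈⇒isSol {x} y≈x+x j = ≈⇒≡% (toℕ (lookup x (src j))) (toℕ (lookup x (tgt j))) (FinP.toℕ<n (y j)) (y≈x+x j)

  exponent≈B : ∀ {x} → IsSol src tgt y x → ∀ u → exponent u ≈ B u (xℤ x)
  exponent≈B {x} sol u = ≈-sum (λ j → ≈-* (u j) (isSol⇒≈ {x} sol j))

  solution⇒kernelCondition : ∀ {x} → IsSol src tgt y x → KernelCondition
  solution⇒kernelCondition {x} sol u inKer = Σ.proj₂ (powIsOne⇔ u) (begin≈
    exponent (toℤ u)                          ≈⟨ exponent≈B {x} sol (toℤ u) ⟩
    B (toℤ u) (xℤ x)                          ≈⟨ ≡⇒≈ (B-expand (toℤ u) (xℤ x)) ⟩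
    sumℤ (λ v → xℤ x v * A· (toℤ u) v)        ≈⟨ ≈-sum (λ v → ≈-* (xℤ x v) (Σ.proj₁ (inKer⇔ u) inKer v)) ⟩
    sumℤ (λ v → xℤ x v * 0ℤ)                  ≈⟨ ≡⇒≈ (sumℤ-zero _ (λ v → ℤP.*-zeroʳ (xℤ x v))) ⟩
    0ℤ                                        ∎≈)

  Φ : V → ℤ
  Φ v = exponent (ψ v)

  Φ-zero : Φ zero ≡ 0ℤ
  Φ-zero = sumℤ-zero _ (λ j → ℤP.*-zeroˡ (yℤ j))

  solution-determined : ∀ {x} → IsSol src tgt y x → ∀ v → xℤ x v ≈ σ v * (xℤ x zero - Φ v)
  solution-determined {x} sol v = begin≈
    xℤ x v                           ≈⟨ ≡⇒≈ (sym (unit-cancel (σ v) (xℤ x v) (unit*self≡1 (unit-σ v)))) ⟩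
    σ v * (σ v * xℤ x v)             ≈⟨ ≡⇒≈ (cong (σ v *_) (shift (xℤ x zero) (σ v * xℤ x v))) ⟩
    σ v * (x₀ - (x₀ - σ v * xℤ x v)) ≈⟨ ≈-* (σ v) (≈-+ (≈-refl {x₀}) (≈-neg B≈Φ)) ⟩
    σ v * (x₀ - Φ v)                 ∎≈
    where
    x₀ : ℤ
    x₀ = xℤ x zero
    B≈Φ : x₀ - σ v * xℤ x v ≈ Φ v
    B≈Φ = ≈-trans (≡⇒≈ (sym (B-ψ v (xℤ x)))) (≈-sym (exponent≈B {x} sol (ψ v)))
    shift : ∀ a b → b ≡ a - (a - b)
    shift = solve-∀
    unit-cancel : ∀ s a → s * s ≡ 1ℤ → s * (s * a) ≡ a
    unit-cancel s a s²≡1 = trans (sym (ℤP.*-assoc s s a)) (trans (cong (_* a) s²≡1) (ℤP.*-identityˡ a))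

  candidateEntry : ℤ → V → Fin d
  candidateEntry t v = reduce (σ v * (t - Φ v))

  candidate : ℤ → Vec (Fin d) (suc n′)
  candidate t = tabulate (candidateEntry t)

  xℤ-candidate : ∀ t v → xℤ (candidate t) v ≈ σ v * (t - Φ v)
  xℤ-candidate t v = ≈-trans (≡⇒≈ (cong (λ i → + toℕ i) (VecP.lookup∘tabulate (candidateEntry t) v))) (reduce-≈ (σ v * (t - Φ v)))

  candidate-cong : ∀ {t t′} → t ≈ t′ → candidate t ≡ candidate t′
  candidate-cong {t} {t′} t≈t′ = VecP.tabulate-cong (λ v → reduce-cong (≈-* (σ v) (≈-+ t≈t′ (≈-refl { - Φ v}))))

  candidate-zero : ∀ t → lookup (candidate t) zero ≡ reduce t
  candidate-zero t = trans (VecP.lookup∘tabulate (candidateEntry t) zero)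
    (cong reduce (trans (ℤP.*-identityˡ (t - Φ zero)) (trans (cong (_-_ t) Φ-zero) (ℤP.+-identityʳ t))))

  candidate-injective : ∀ {t t′} → candidate t ≡ candidate t′ → t ≈ t′
  candidate-injective {t} {t′} eq = begin≈
    t                       ≈⟨ ≈-sym (reduce-≈ t) ⟩
    + toℕ (reduce t)        ≈⟨ ≡⇒≈ (cong (λ x → + toℕ x) (trans (sym (candidate-zero t)) (trans (cong (λ x → lookup x zero) eq) (candidate-zero t′)))) ⟩
    + toℕ (reduce t′)       ≈⟨ reduce-≈ t′ ⟩
    t′                      ∎≈

  solution≡candidate : ∀ {x} → IsSol src tgt y x → x ≡ candidate (xℤ x zero)
  solution≡candidate {x} sol = trans (sym (VecP.tabulate∘lookup x)) (VecP.tabulate-cong λ v →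
    ≈⇒Fin-≡ {lookup x v} (≈-trans (solution-determined {x} sol v) (≈-sym (reduce-≈ (σ v * (xℤ x zero - Φ v))))))

  EdgeCondition : ℤ → Fin m → Set
  EdgeCondition t j = (σ (src j) + σ (tgt j)) * t ≈ exponent (cycleVector j)

  exponent-cycleVector : ∀ j → exponent (cycleVector j) ≡ (σ (src j) * Φ (src j) + σ (tgt j) * Φ (tgt j)) + yℤ j
  exponent-cycleVector j = begin
    exponent (cycleVector j)
      ≡⟨ exponent-+ (λ i → σ s * ψ s i + σ t * ψ t i) (δ j) ⟩
    exponent (λ i → σ s * ψ s i + σ t * ψ t i) + exponent (δ j)
      ≡⟨ cong₂ _+_ (trans (exponent-+ (λ i → σ s * ψ s i) (λ i → σ t * ψ t i))
                          (cong₂ _+_ (exponent-* (σ s) (ψ s)) (exponent-* (σ t) (ψ t))))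
                   (exponent-δ j) ⟩
    (σ s * Φ s + σ t * Φ t) + yℤ j ∎
    where
    s t : V
    s = src j
    t = tgt j

  candidate-edge : ∀ t j → σ (src j) * (t - Φ (src j)) + σ (tgt j) * (t - Φ (tgt j))
                         ≡ ((σ (src j) + σ (tgt j)) * t - exponent (cycleVector j)) + yℤ j
  candidate-edge t j = trans (regroup (σ (src j)) (σ (tgt j)) t (Φ (src j)) (Φ (tgt j)) (yℤ j))
    (cong (λ e → ((σ (src j) + σ (tgt j)) * t - e) + yℤ j) (sym (exponent-cycleVector j)))
    where
    regroup : ∀ p q t a b y → p * (t - a) + q * (t - b) ≡ ((p + q) * t - ((p * a + q * b) + y)) + y
    regroup = solve-∀

  candidate-solves : ∀ t → (∀ j → EdgeCondition t j) → IsSol src tgt y (candidate t)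
  candidate-solves t edges = ≈⇒isSol {candidate t} λ j → ≈-sym (begin≈
    xℤ (candidate t) (src j) + xℤ (candidate t) (tgt j)
      ≈⟨ ≈-+ (xℤ-candidate t (src j)) (xℤ-candidate t (tgt j)) ⟩
    σ (src j) * (t - Φ (src j)) + σ (tgt j) * (t - Φ (tgt j))
      ≈⟨ ≡⇒≈ (candidate-edge t j) ⟩
    ((σ (src j) + σ (tgt j)) * t - exponent (cycleVector j)) + yℤ j
      ≈⟨ ≈-+ (≈-+ (edges j) (≈-refl { - exponent (cycleVector j)})) (≈-refl {yℤ j}) ⟩
    (exponent (cycleVector j) - exponent (cycleVector j)) + yℤ j
      ≈⟨ ≡⇒≈ (trans (cong (_+ yℤ j) (ℤP.+-inverseʳ (exponent (cycleVector j)))) (ℤP.+-identityˡ (yℤ j))) ⟩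
    yℤ j ∎≈)

  solves⇒edgeCondition : ∀ t → IsSol src tgt y (candidate t) → ∀ j → EdgeCondition t j
  solves⇒edgeCondition t sol j = begin≈
    a                       ≈⟨ ≡⇒≈ (unshift a e (yℤ j)) ⟩
    ((a - e) + yℤ j) - yℤ j + e
      ≈⟨ ≈-+ (≈-+ (≈-trans (≡⇒≈ (sym (candidate-edge t j)))
                   (≈-trans (≈-sym (≈-+ (xℤ-candidate t (src j)) (xℤ-candidate t (tgt j))))
                            (≈-sym (isSol⇒≈ {candidate t} sol j))))
                  (≈-refl { - yℤ j}))
             (≈-refl {e}) ⟩
    yℤ j - yℤ j + e         ≈⟨ ≡⇒≈ (trans (cong (_+ e) (ℤP.+-inverseʳ (yℤ j))) (ℤP.+-identityˡ e)) ⟩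
    e                       ∎≈
    where
    a e : ℤ
    a = (σ (src j) + σ (tgt j)) * t
    e = exponent (cycleVector j)
    unshift : ∀ a e y → a ≡ ((a - e) + y) - y + e
    unshift = solve-∀

  σ-oddEdge : ∀ {j} → σ (src j) + σ (tgt j) ≢ 0ℤ → σ (tgt j) ≡ σ (src j)
  σ-oddEdge {j} = units-sum≢0⇒≡ (unit-σ (src j)) (unit-σ (tgt j))

  edgeCondition-oddEdge : ∀ {t j} → σ (tgt j) ≡ σ (src j) →
    (EdgeCondition t j → + 2 * t ≈ exponent (oddCycleVector j)) × (+ 2 * t ≈ exponent (oddCycleVector j) → EdgeCondition t j)
  edgeCondition-oddEdge {t} {j} σt≡σs =
      (λ edge → ≈-trans (≡⇒≈ 2t≡) (≈-trans (≈-* q edge) (≡⇒≈ (sym (exponent-* q (cycleVector j))))))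
    , (λ 2t≈ → ≈-trans (≡⇒≈ lhs≡) (≈-trans (≈-* q 2t≈) (≡⇒≈ (trans (cong (q *_) (exponent-* q (cycleVector j))) (cancel (exponent (cycleVector j)))))))
    where
    q : ℤ
    q = σ (src j)
    cancel : ∀ a → q * (q * a) ≡ a
    cancel a = trans (sym (ℤP.*-assoc q q a)) (trans (cong (_* a) (unit*self≡1 (unit-σ (src j)))) (ℤP.*-identityˡ a))
    double : ∀ q t → (q + q) * t ≡ q * (+ 2 * t)
    double = solve-∀
    lhs≡ : (σ (src j) + σ (tgt j)) * t ≡ q * (+ 2 * t)
    lhs≡ = trans (cong (λ s → (q + s) * t) σt≡σs) (double q t)
    2t≡ : + 2 * t ≡ q * ((σ (src j) + σ (tgt j)) * t)
    2t≡ = sym (trans (cong (q *_) lhs≡) (cancel (+ 2 * t)))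

  module WithKernelCondition (kernel : KernelCondition) where

    kernelCondition-B : ∀ u → (∀ v → B u (δ v) ≡ 0ℤ) → exponent u ≈ 0ℤ
    kernelCondition-B u B≡0 = kernelCondition-ℤ kernel u (λ v → ≡⇒≈ (trans (sym (B-δᵛ u v)) (B≡0 v)))

    edgeCondition-evenEdge : ∀ t j → σ (src j) + σ (tgt j) ≡ 0ℤ → EdgeCondition t j
    edgeCondition-evenEdge t j even = ≈-trans (≡⇒≈ (trans (cong (_* t) even) (ℤP.*-zeroˡ t)))
      (≈-sym (kernelCondition-B (cycleVector j) (λ v → trans (B-cycleVector j (δ v)) (trans (cong (_* δ v zero) even) (ℤP.*-zeroˡ (δ v zero))))))

    oddCycleVectors-agree : ∀ {j j′} → σ (tgt j) ≡ σ (src j) → σ (tgt j′) ≡ σ (src j′) →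
      exponent (oddCycleVector j) ≈ exponent (oddCycleVector j′)
    oddCycleVectors-agree {j} {j′} odd odd′ = ≈-trans (x-y≈z⇒x≈z+y e e′ 0ℤ difference≈0) (≡⇒≈ (ℤP.+-identityˡ e′))
      where
      e e′ : ℤ
      e = exponent (oddCycleVector j)
      e′ = exponent (oddCycleVector j′)
      W : Fin m → ℤ
      W i = oddCycleVector j i + -1ℤ * oddCycleVector j′ i
      cancel : ∀ a → + 2 * a + -1ℤ * (+ 2 * a) ≡ 0ℤ
      cancel = solve-∀
      B-W : ∀ z → B W z ≡ 0ℤ
      B-W z = trans (B-+ (oddCycleVector j) (λ i → -1ℤ * oddCycleVector j′ i) z)
        (trans (cong₂ _+_ (B-oddCycleVector j odd z) (trans (B-* -1ℤ (oddCycleVector j′) z) (cong (-1ℤ *_) (B-oddCycleVector j′ odd′ z))))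
               (cancel (z zero)))
      difference≈0 : e - e′ ≈ 0ℤ
      difference≈0 = ≈-trans (≡⇒≈ (sym (trans (exponent-+ (oddCycleVector j) (λ i → -1ℤ * oddCycleVector j′ i))
                                              (cong (_+_ e) (trans (exponent-* -1ℤ (oddCycleVector j′)) (ℤP.-1*i≡-i e′))))))
                             (kernelCondition-B W (λ v → B-W (δ v)))

    candidate-solves-bipartite : Bipartite → ∀ t → IsSol src tgt y (candidate t)
    candidate-solves-bipartite bipartite t = candidate-solves t (λ j → edgeCondition-evenEdge t j (bipartite j))

    module OddEdge (j₀ : Fin m) (odd₀ : σ (src j₀) + σ (tgt j₀) ≢ 0ℤ) where

      K : ℤ
      K = exponent (oddCycleVector j₀)

      Root : ℤ → Set
      Root t = + 2 * t ≈ K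

      root⇒solves : ∀ t → Root t → IsSol src tgt y (candidate t)
      root⇒solves t root = candidate-solves t edge
        where
        edge : ∀ j → EdgeCondition t j
        edge j with σ (src j) + σ (tgt j) ℤ.≟ 0ℤ
        ... | yes even = edgeCondition-evenEdge t j even
        ... | no odd   = Σ.proj₂ (edgeCondition-oddEdge (σ-oddEdge odd))
                           (≈-trans root (oddCycleVectors-agree (σ-oddEdge odd₀) (σ-oddEdge odd)))

      solution⇒root : ∀ {x} → IsSol src tgt y x → Root (xℤ x zero)
      solution⇒root {x} sol = Σ.proj₁ (edgeCondition-oddEdge (σ-oddEdge odd₀))
        (solves⇒edgeCondition (xℤ x zero) (subst (IsSol src tgt y) (solution≡candidate {x} sol) sol) j₀)

      roots-differ : ∀ {a b} → Root a → Root b → + 2 * (a - b) ≈ 0ℤ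
      roots-differ {a} {b} root-a root-b =
        ≈-trans (≡⇒≈ (distrib a b)) (≈-trans (≈-+ root-a (≈-neg root-b)) (≡⇒≈ (ℤP.+-inverseʳ K)))
        where
        distrib : ∀ a b → + 2 * (a - b) ≡ + 2 * a + - (+ 2 * b)
        distrib = solve-∀

      -- 2 is invertible modulo d = 2h + 1, with inverse h + 1
      root-oddModulus : ∀ h → d ≡ suc (h ℕ.* 2) → Root (K * + suc h)
      root-oddModulus h d≡2h+1 = multipleOf K (begin
        + 2 * (K * + suc h) - K       ≡⟨ cong (λ s → + 2 * (K * s) - K) (ℤP.pos-+ 1 h) ⟩
        + 2 * (K * (1ℤ + + h)) - K    ≡⟨ expand (+ h) K ⟩
        K * (1ℤ + + h * + 2)          ≡⟨ cong (λ s → K * (1ℤ + s)) (sym (ℤP.pos-* h 2)) ⟩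
        K * (1ℤ + + (h ℕ.* 2))        ≡⟨ cong (K *_) (sym (ℤP.pos-+ 1 (h ℕ.* 2))) ⟩
        K * + suc (h ℕ.* 2)           ≡⟨ cong (λ s → K * + s) (sym d≡2h+1) ⟩
        K * + d                       ∎)
        where
        expand : ∀ h K → + 2 * (K * (1ℤ + h)) - K ≡ K * (1ℤ + h * + 2)
        expand = solve-∀

      -- the kernel vector (h + 1)·oddCycleVector j₀ forces K to be even
      root-evenModulus : ∀ h → d ≡ suc h ℕ.* 2 → Σ ℤ Root
      root-evenModulus h d≡2H = rootOf (kernelCondition-ℤ kernel Hv A·Hv≈0)
        where
        H : ℤ
        H = + suc h
        Hv : Fin m → ℤ
        Hv i = H * oddCycleVector j₀ i
        d≡H*2 : + d ≡ H * + 2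
        d≡H*2 = trans (cong +_ d≡2H) (ℤP.pos-* (suc h) 2)
        reorder : ∀ h z → h * (+ 2 * z) ≡ z * (h * + 2)
        reorder = solve-∀
        A·Hv≈0 : ∀ v → A· Hv v ≈ 0ℤ
        A·Hv≈0 v = ≈-trans (≡⇒≈ (begin
          A· Hv v                          ≡⟨ sym (B-δᵛ Hv v) ⟩
          B Hv (δ v)                       ≡⟨ B-* H (oddCycleVector j₀) (δ v) ⟩
          H * B (oddCycleVector j₀) (δ v)  ≡⟨ cong (H *_) (B-oddCycleVector j₀ (σ-oddEdge odd₀) (δ v)) ⟩
          H * (+ 2 * δ v zero)             ≡⟨ reorder H (δ v zero) ⟩
          δ v zero * (H * + 2)             ≡⟨ cong (δ v zero *_) (sym d≡H*2) ⟩
          δ v zero * + d                   ∎)) (multiple≈0 (δ v zero))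
        swap : ∀ r h → r * (h * + 2) ≡ h * (r * + 2)
        swap = solve-∀
        rootOf : exponent Hv ≈ 0ℤ → Σ ℤ Root
        rootOf (multipleOf r HK-0≡rd) = r , ≡⇒≈ (trans (ℤP.*-comm (+ 2) r) (sym (ℤP.*-cancelˡ-≡ H K (r * + 2) HK≡H2r)))
          where
          HK≡H2r : H * K ≡ H * (r * + 2)
          HK≡H2r = begin
            H * K                 ≡⟨ sym (exponent-* H (oddCycleVector j₀)) ⟩
            exponent Hv           ≡⟨ sym (ℤP.+-identityʳ (exponent Hv)) ⟩
            exponent Hv - 0ℤ      ≡⟨ HK-0≡rd ⟩
            r * + d               ≡⟨ cong (r *_) d≡H*2 ⟩
            r * (H * + 2)         ≡⟨ swap r H ⟩
            H * (r * + 2)         ∎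

      exactlyOne : ∀ h → d ≡ suc (h ℕ.* 2) → ExactlyN 1 (IsSol src tgt y)
      exactlyOne h d≡2h+1 = candidate t₀ ∷ [] , refl , [] ∷ [] , λ x → mk⇔ (solves x) (listed x)
        where
        t₀ : ℤ
        t₀ = K * + suc h
        solves : ∀ x → x ∈ candidate t₀ ∷ [] → IsSol src tgt y x
        solves x (here refl) = root⇒solves t₀ (root-oddModulus h d≡2h+1)
        listed : ∀ x → IsSol src tgt y x → x ∈ candidate t₀ ∷ []
        listed x sol = here (trans (solution≡candidate {x} sol) (candidate-cong (≈-trans x₀≈ (≡⇒≈ (ℤP.+-identityˡ t₀)))))
          where
          x₀ : ℤ
          x₀ = xℤ x zero
          x₀≈ : x₀ ≈ 0ℤ + t₀
          x₀≈ = x-y≈z⇒x≈z+y x₀ t₀ 0ℤ (2*≈0⇒≈0 h d≡2h+1 (x₀ - t₀) (roots-differ {x₀} {t₀} (solution⇒root {x} sol) (root-oddModulus h d≡2h+1)))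

      exactlyTwo : ∀ h → d ≡ suc h ℕ.* 2 → ExactlyN 2 (IsSol src tgt y)
      exactlyTwo h d≡2H = candidate t₀ ∷ candidate t₁ ∷ [] , refl , (distinct ∷ []) ∷ [] ∷ [] , λ x → mk⇔ (solves x) (listed x)
        where
        H : ℤ
        H = + suc h
        t₀ : ℤ
        t₀ = Σ.proj₁ (root-evenModulus h d≡2H)
        root₀ : Root t₀
        root₀ = Σ.proj₂ (root-evenModulus h d≡2H)
        t₁ : ℤ
        t₁ = t₀ + H
        2H≡d : + 2 * H ≡ + d
        2H≡d = trans (ℤP.*-comm (+ 2) H) (trans (sym (ℤP.pos-* (suc h) 2)) (cong +_ (sym d≡2H)))
        root₁ : Root t₁
        root₁ = ≈-trans (multipleOf 1ℤ (trans (shift t₀ H) (trans 2H≡d (sym (ℤP.*-identityˡ (+ d)))))) root₀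
          where
          shift : ∀ t h → + 2 * (t + h) - + 2 * t ≡ + 2 * h
          shift = solve-∀
        distinct : candidate t₀ ≢ candidate t₁
        distinct eq = case ≈⇒≡ {suc h} {0} H<d (ℕP.<-trans (ℕ.s≤s ℕ.z≤n) H<d) H≈0 of λ ()
          where
          H<d : suc h ℕ.< d
          H<d = subst (suc h ℕ.<_) (sym d≡2H) (ℕP.m<m*n (suc h) 2 (ℕ.s≤s (ℕ.s≤s ℕ.z≤n)))
          unshift : ∀ t h → h ≡ (t + h) - t
          unshift = solve-∀
          H≈0 : H ≈ 0ℤ
          H≈0 = ≈-trans (≡⇒≈ (unshift t₀ H)) (≈-trans (≈-+ (≈-sym (candidate-injective {t₀} {t₁} eq)) (≈-refl { - t₀})) (≡⇒≈ (ℤP.+-inverseʳ t₀)))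
        solves : ∀ x → x ∈ candidate t₀ ∷ candidate t₁ ∷ [] → IsSol src tgt y x
        solves x (here refl)         = root⇒solves t₀ root₀
        solves x (there (here refl)) = root⇒solves t₁ root₁
        listed : ∀ x → IsSol src tgt y x → x ∈ candidate t₀ ∷ candidate t₁ ∷ []
        listed x sol = byHalf (2*≈0⇒≈0⊎≈half h d≡2H (x₀ - t₀) (roots-differ {x₀} {t₀} (solution⇒root {x} sol) root₀))
          where
          x₀ : ℤ
          x₀ = xℤ x zero
          byHalf : (x₀ - t₀ ≈ 0ℤ) ⊎ (x₀ - t₀ ≈ H) → x ∈ candidate t₀ ∷ candidate t₁ ∷ []
          byHalf (inj₁ diff≈0) = here (trans (solution≡candidate {x} sol)
            (candidate-cong (≈-trans (x-y≈z⇒x≈z+y x₀ t₀ 0ℤ diff≈0) (≡⇒≈ (ℤP.+-identityˡ t₀)))))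
          byHalf (inj₂ diff≈H) = there (here (trans (solution≡candidate {x} sol)
            (candidate-cong (≈-trans (x-y≈z⇒x≈z+y x₀ t₀ H diff≈H) (≡⇒≈ (ℤP.+-comm H t₀))))))


    exactly-bipartite : Bipartite → ExactlyN d (IsSol src tgt y)
    exactly-bipartite bipartite = xs , length-xs , unique , λ x → mk⇔ (solves x) (listed x)
      where
      fromFin : Fin d → Vec (Fin d) (suc n′)
      fromFin i = candidate (+ toℕ i)
      xs : List (Vec (Fin d) (suc n′))
      xs = map fromFin (allFin d)
      length-xs : length xs ≡ d
      length-xs = trans (ListP.length-map fromFin (allFin d)) (ListP.length-tabulate (λ i → i))
      fromFin-injective : ∀ {i j} → fromFin i ≡ fromFin j → i ≡ j
      fromFin-injective {i} {j} eq = ≈⇒Fin-≡ {i} {j} (candidate-injective {+ toℕ i} {+ toℕ j} eq)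
      unique : Unique xs
      unique = UniqueP.map⁺ fromFin-injective (UniqueP.allFin⁺ d)
      solves : ∀ x → x ∈ xs → IsSol src tgt y x
      solves x x∈ with ∈-map⁻ fromFin x∈
      ... | i , _ , refl = candidate-solves-bipartite bipartite (+ toℕ i)
      listed : ∀ x → IsSol src tgt y x → x ∈ xs
      listed x sol = subst (_∈ xs) (sym (solution≡candidate {x} sol)) (∈-map⁺ fromFin (∈-allFin (lookup x zero)))

even⊎odd : ∀ n → (∃ λ q → n ≡ q ℕ.* 2) ⊎ (∃ λ q → n ≡ suc (q ℕ.* 2))
even⊎odd n with n ℕ.% 2 | ℕD.m%n<n n 2 | ℕD.m≡m%n+[m/n]*n n 2
... | 0           | _                        | n≡ = inj₁ (n ℕ./ 2 , n≡)
... | 1           | _                        | n≡ = inj₂ (n ℕ./ 2 , n≡)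
... | suc (suc _) | ℕ.s≤s (ℕ.s≤s ())      | _

module Theorem (d : ℕ) .{{_ : NonZero d}} (2≤d : 2 ≤ d) {n′ m} (src tgt : Fin m → Fin (suc n′))
               (loopless : Loopless src tgt) (connected : Connected src tgt) (y : Fin m → Fin d) where
  open Graph src tgt loopless connected
  open Solutions d src tgt loopless connected y
  open WithKernelCondition

  Solvable : Set
  Solvable = ∃ λ (x : Vec (Fin d) (suc n′)) → IsSol src tgt y x

  2≢0 : 2 ≢ 0
  2≢0 ()

  d≢0 : d ≢ 0
  d≢0 = ℕP.m<n⇒n≢0 2≤d

  solvable-of-oddEdge : (kernel : KernelCondition) → ∀ j₀ (odd₀ : σ (src j₀) + σ (tgt j₀) ≢ 0ℤ) → Solvable
  solvable-of-oddEdge kernel j₀ odd₀ = byParity (even⊎odd d)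
    where
    open OddEdge kernel j₀ odd₀
    byParity : (∃ λ q → d ≡ q ℕ.* 2) ⊎ (∃ λ q → d ≡ suc (q ℕ.* 2)) → Solvable
    byParity (inj₂ (h , d≡2h+1))   = candidate (K * + suc h) , root⇒solves (K * + suc h) (root-oddModulus h d≡2h+1)
    byParity (inj₁ (suc h , d≡2H)) = let (t , root) = root-evenModulus h d≡2H in candidate t , root⇒solves t root
    byParity (inj₁ (zero , d≡0))   = ⊥-elim (d≢0 d≡0)

  solvable⇔kernelCondition : Solvable ⇔ KernelCondition
  solvable⇔kernelCondition = mk⇔ (λ (x , sol) → solution⇒kernelCondition {x} sol) solvable
    where
    solvable : KernelCondition → Solvable
    solvable kernel with bipartite⊎oddEdge
    ... | inj₁ bipartite   = candidate 0ℤ , candidate-solves-bipartite kernel bipartite 0ℤ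
    ... | inj₂ (j₀ , odd₀) = solvable-of-oddEdge kernel j₀ odd₀

  count-g≡0 : Solvable → gMinors src tgt ≡ 0 → ExactlyN d (IsSol src tgt y)
  count-g≡0 (x , sol) g≡0 with bipartite⊎oddEdge
  ... | inj₁ bipartite  = exactly-bipartite (solution⇒kernelCondition {x} sol) bipartite
  ... | inj₂ (_ , odd₀) = ⊥-elim (2≢0 (trans (sym (gMinors≡2 odd₀)) g≡0))

  count-g≡2-even : Solvable → gMinors src tgt ≡ 2 → 2 ∣ d → ExactlyN 2 (IsSol src tgt y)
  count-g≡2-even (x , sol) g≡2 (divides q d≡2q) with bipartite⊎oddEdge | q
  ... | inj₁ bipartite  | _ = ⊥-elim (2≢0 (trans (sym g≡2) (gMinors≡0 bipartite)))
  ... | inj₂ (j₀ , odd₀) | zero  = ⊥-elim (d≢0 d≡2q)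
  ... | inj₂ (j₀ , odd₀) | suc h = OddEdge.exactlyTwo (solution⇒kernelCondition {x} sol) j₀ odd₀ h d≡2q

  count-otherwise : Solvable → ¬ (gMinors src tgt ≡ 0) → ¬ (gMinors src tgt ≡ 2 × 2 ∣ d) → ExactlyN 1 (IsSol src tgt y)
  count-otherwise (x , sol) g≢0 ¬[g≡2∧2∣d] with bipartite⊎oddEdge
  ... | inj₁ bipartite   = ⊥-elim (g≢0 (gMinors≡0 bipartite))
  ... | inj₂ (j₀ , odd₀) with even⊎odd d
  ...   | inj₁ (q , d≡2q)   = ⊥-elim (¬[g≡2∧2∣d] (gMinors≡2 odd₀ , divides q d≡2q))
  ...   | inj₂ (h , d≡2h+1) = OddEdge.exactlyOne (solution⇒kernelCondition {x} sol) j₀ odd₀ h d≡2h+1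

Conclusion : (d : ℕ) .{{_ : NonZero d}} {n m : ℕ} (src tgt : Fin m → Fin n) (y : Fin m → Fin d) → Set
Conclusion d {n} {m} src tgt y =
    ((∃ λ (x : Vec (Fin d) n) → IsSol src tgt y x)
       ⇔ (∀ (u : Fin m → Fin d) → InKer src tgt u → PowIsOne y u))
    × ((∃ λ (x : Vec (Fin d) n) → IsSol src tgt y x) →
         gMinors src tgt ≡ 0 → ExactlyN d (IsSol src tgt y))
    × ((∃ λ (x : Vec (Fin d) n) → IsSol src tgt y x) →
         gMinors src tgt ≡ 2 → 2 ∣ d → ExactlyN 2 (IsSol src tgt y))
    × ((∃ λ (x : Vec (Fin d) n) → IsSol src tgt y x) →
         ¬ (gMinors src tgt ≡ 0) → ¬ (gMinors src tgt ≡ 2 × 2 ∣ d) →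
         ExactlyN 1 (IsSol src tgt y))

conclusion-connected : (d : ℕ) .{{_ : NonZero d}} → 2 ≤ d → ∀ {n′ m} (src tgt : Fin m → Fin (suc n′)) →
  Loopless src tgt → Connected src tgt → (y : Fin m → Fin d) → Conclusion d src tgt y
conclusion-connected d 2≤d src tgt loopless connected y =
  solvable⇔kernelCondition , count-g≡0 , count-g≡2-even , count-otherwise
  where
  open Theorem d 2≤d src tgt loopless connected y

-- Without vertices there are no edges, g = gcd of the empty minor = 1, and [] is the only solution.
conclusion-noVertices : (d : ℕ) .{{_ : NonZero d}} (src tgt : Fin 0 → Fin 0) (y : Fin 0 → Fin d) →
  Conclusion d src tgt y
conclusion-noVertices d src tgt y =
    mk⇔ (λ _ _ _ → ℕD.m*n%n≡0 0 d) (λ _ → [] , λ ())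
  , (λ _ ())
  , (λ _ ())
  , λ _ _ _ → [] ∷ [] , refl , [] ∷ [] , λ { [] → mk⇔ (λ _ ()) (λ _ → here refl) }

theorem5 : (d : ℕ) .{{_ : NonZero d}} → 2 ≤ d →
    (n m : ℕ) (src tgt : Fin m → Fin n) →
    Loopless src tgt → NoMultiEdges src tgt → Connected src tgt →
    (y : Fin m → Fin d) →
    ((∃ λ (x : Vec (Fin d) n) → IsSol src tgt y x)
       ⇔ (∀ (u : Fin m → Fin d) → InKer src tgt u → PowIsOne y u))
    × ((∃ λ (x : Vec (Fin d) n) → IsSol src tgt y x) →
         gMinors src tgt ≡ 0 → ExactlyN d (IsSol src tgt y))
    × ((∃ λ (x : Vec (Fin d) n) → IsSol src tgt y x) →
         gMinors src tgt ≡ 2 → 2 ∣ d → ExactlyN 2 (IsSol src tgt y))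
    × ((∃ λ (x : Vec (Fin d) n) → IsSol src tgt y x) →
         ¬ (gMinors src tgt ≡ 0) → ¬ (gMinors src tgt ≡ 2 × 2 ∣ d) →
         ExactlyN 1 (IsSol src tgt y))
-- Parallel edges do no harm.
theorem5 d 2≤d (suc n′) m src tgt loopless _ connected y = conclusion-connected d 2≤d src tgt loopless connected y
theorem5 d 2≤d zero (suc m) src tgt _ _ _ y = case src zero of λ ()
theorem5 d 2≤d zero zero    src tgt _ _ _ y = conclusion-noVertices d src tgt y
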